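{- Let $k\ge1$ and $\sigma\in S_k$. Then for every integer $n\ge k+1$, $$a^{(1)}_\sigma(n)=\frac{1}{P(n,k)}\sum_{i=1}^{n}\sum_{j=1}^{k}\binom{i-1}{j-1}\binom{i-1}{\sigma(j)-1}\binom{n-i}{k-j}\binom{n-i}{k-\sigma(j)}-\frac1{k!}\binom{n-1}{k-1}.$$
   Context: $P(n,k)=n(n-1)\cdots(n-k+1)$. For $\pi\in S_n$, $N_\sigma(\pi)$ is the number of occurrences of $\sigma$ in $\pi$ (sequences $i_1<\dots<i_k$ with $\pi(i_a)>\pi(i_b)$ iff $\sigma(a)>\sigma(b)$), and $M_{\sigma,n}(\pi)$ is the average of $N_\sigma$ over the conjugacy class of $\pi$ in $S_n$. $a^{(1)}_\sigma(n)$ is the unique polynomial in $n$ (of degree at most $k-1$) with $a^{(1)}_\sigma(n)=\langle\chi^{(n-1,1)},M_{\sigma,n}\rangle$ for all $n\ge k+1$, where $\chi^{(n-1,1)}$ is the irreducible character of $S_n$ for $(n-1,1)$ and $\langle f,g\rangle=\frac1{n!}\sum_{\pi\in S_n}f(\pi)\overline{g(\pi)}$. -}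

module Defs where

open import Data.Bool using (Bool; true; false; not; _∧_; if_then_else_)
open import Data.Nat as ℕ using (ℕ; zero; suc; _∸_; _<ᵇ_; _!)
open import Data.Nat.Combinatorics using (_C_; _P_)
open import Data.Fin as Fin using (Fin; toℕ)
open import Data.Vec as Vec using (Vec; []; _∷_; lookup)
open import Data.List as List using (List; []; _∷_; [_]; map; concatMap; allFin; length; foldr)
open import Data.Bool.ListAction using (all; any)
open import Data.Integer using (+_)
open import Data.Rational as ℚ using (ℚ; 0ℚ; 1ℚ; _+_; _*_; _-_)
open import Data.Fin.Permutation using (Permutation′; _⟨$⟩ʳ_)
open import Relation.Nullary using (does)

ℕ→ℚ : ℕ → ℚ
ℕ→ℚ m = ℚ._/_ (+ m) 1

-- division by a natural number (only ever used with a nonzero divisor;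
-- division by 0 is set to 0 merely to make the function total)
_÷ℕ_ : ℚ → ℕ → ℚ
q ÷ℕ zero  = 0ℚ
q ÷ℕ suc m = q * ℚ._/_ (+ 1) (suc m)

sumℚ : List ℚ → ℚ
sumℚ = foldr _+_ 0ℚ

sumℕ : List ℕ → ℕ
sumℕ = foldr ℕ._+_ 0

filterᵇ : {A : Set} → (A → Bool) → List A → List A
filterᵇ p []       = []
filterᵇ p (x ∷ xs) = if p x then x ∷ filterᵇ p xs else filterᵇ p xs

_==_ : {n : ℕ} → Fin n → Fin n → Bool
x == y = does (x Fin.≟ y)

-- The symmetric group S_n, as the list of all bijections Fin n → Fin n,
-- each represented by its table of values (a vector of length n).

allVecs : (n m : ℕ) → List (Vec (Fin n) m)
allVecs n zero    = [ [] ]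
allVecs n (suc m) = concatMap (λ x → map (x ∷_) (allVecs n m)) (allFin n)

isInjective : {n : ℕ} → Vec (Fin n) n → Bool
isInjective {n} v =
  all (λ i → all (λ j → (i == j) Data.Bool.∨ not (lookup v i == lookup v j))
                 (allFin n)) (allFin n)
  where import Data.Bool

Perm : ℕ → Set
Perm n = Vec (Fin n) n

Sym : (n : ℕ) → List (Perm n)
Sym n = filterᵇ isInjective (allVecs n n)

increasing : {n k : ℕ} → Vec (Fin n) k → Bool
increasing {n} {k} idx =
  all (λ a → all (λ b → not (toℕ a <ᵇ toℕ b) Data.Bool.∨
                         (toℕ (lookup idx a) <ᵇ toℕ (lookup idx b)))
                 (allFin k)) (allFin k)
  where import Data.Bool

_⇔ᵇ_ : Bool → Bool → Bool
true  ⇔ᵇ b = b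
false ⇔ᵇ b = not b

isPattern : {n k : ℕ} → Permutation′ k → Perm n → Vec (Fin n) k → Bool
isPattern {n} {k} σ π idx =
  all (λ a → all (λ b →
        (toℕ (lookup π (lookup idx b)) <ᵇ toℕ (lookup π (lookup idx a)))
        ⇔ᵇ (toℕ (σ ⟨$⟩ʳ b) <ᵇ toℕ (σ ⟨$⟩ʳ a)))
      (allFin k)) (allFin k)

isOccurrence : {n k : ℕ} → Permutation′ k → Perm n → Vec (Fin n) k → Bool
isOccurrence σ π idx = increasing idx ∧ isPattern σ π idx

N : {k n : ℕ} → Permutation′ k → Perm n → ℕ
N {k} {n} σ π = length (filterᵇ (isOccurrence σ π) (allVecs n k))

-- τ is conjugate to π in S_n : τ = g π g⁻¹ for some g ∈ S_n,
-- i.e. g ∘ π = τ ∘ g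
conjugate : {n : ℕ} → Perm n → Perm n → Bool
conjugate {n} π τ =
  any (λ g → all (λ x → lookup g (lookup π x) == lookup τ (lookup g x))
                 (allFin n)) (Sym n)

conjClass : {n : ℕ} → Perm n → List (Perm n)
conjClass {n} π = filterᵇ (conjugate π) (Sym n)

M : {k : ℕ} → Permutation′ k → (n : ℕ) → Perm n → ℚ
M σ n π = sumℚ (map (λ τ → ℕ→ℚ (N σ τ)) (conjClass π)) ÷ℕ length (conjClass π)

-- The character χ^{(n-1,1)} of the standard representation:
-- χ^{(n-1,1)}(π) = #fix(π) - 1.

fixedPoints : {n : ℕ} → Perm n → ℕ
fixedPoints {n} π = length (filterᵇ (λ x → lookup π x == x) (allFin n))

χstd : (n : ℕ) → Perm n → ℚ
χstd n π = ℕ→ℚ (fixedPoints π) - 1ℚ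

-- ⟨f,g⟩ = (1/n!) Σ_{π ∈ S_n} f(π) g(π)   (all functions are rational-valued,
-- so complex conjugation is the identity)
inner : (n : ℕ) → (Perm n → ℚ) → (Perm n → ℚ) → ℚ
inner n f g = sumℚ (map (λ π → f π * g π) (Sym n)) ÷ℕ (n !)

-- ⟨χ^{(n-1,1)}, M_{σ,n}⟩ ; by definition equal to a^{(1)}_σ(n) for n ≥ k+1
a1 : {k : ℕ} → Permutation′ k → (n : ℕ) → ℚ
a1 σ n = inner n (χstd n) (M σ n)

-- Right-hand side of Proposition 3.1.
-- Indices: i = i'+1 with i' ∈ {0..n-1}, j = j'+1 with j' ∈ Fin k,
-- σ(j) - 1 = toℕ (σ ⟨$⟩ʳ j').

doubleSum : {k : ℕ} → Permutation′ k → (n : ℕ) → ℕ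
doubleSum {k} σ n =
  sumℕ (map (λ i → sumℕ (map (λ j →
      (toℕ i C toℕ j) ℕ.* (toℕ i C toℕ (σ ⟨$⟩ʳ j))
      ℕ.* ((n ∸ suc (toℕ i)) C (k ∸ suc (toℕ j)))
      ℕ.* ((n ∸ suc (toℕ i)) C (k ∸ suc (toℕ (σ ⟨$⟩ʳ j)))))
    (allFin k))) (allFin n))

rhs : {k : ℕ} → Permutation′ k → (n : ℕ) → ℚ
rhs {k} σ n = (ℕ→ℚ (doubleSum σ n) ÷ℕ (n P k))
              - (ℕ→ℚ ((n ∸ 1) C (k ∸ 1)) ÷ℕ (k !))

{-# OPTIONS --safe #-}
module Submission where

-- χ^{(n-1,1)}(π) = fix(π) − 1 is a class function and M_{σ,n} averages N_σ over conjugacy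
-- classes, so ⟨χ^{(n-1,1)}, M_{σ,n}⟩ = (1/n!) Σ_π (fix(π) − 1) N_σ(π).  Both Σ_π N_σ(π) and
-- Σ_π fix(π) N_σ(π) are computed by summing first over the k-subsets I of positions.  After
-- permuting positions so that I comes first, the permutations with an occurrence of σ at I are
-- the (n−k)! extensions of the C(n,k) value vectors order-isomorphic to σ.  A fixed point at the
-- j-th element i of I pins the value at position j to i, which leaves
-- C(i−1, σ(j)−1) C(n−i, k−σ(j)) value vectors, and i is the j-th element of
-- C(i−1, j−1) C(n−i, k−j) subsets I: this is the double sum.  A fixed point x outside I leaves the
-- C(n−1, k) value vectors avoiding x, each with (n−k−1)! extensions.  Pascal's rule and
-- n! = P(n,k) (n−k)! = k! C(n,k) (n−k)! turn the difference into the closed form.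

open import Algebra.Bundles using (CommutativeSemiring)

module ListSum {c ℓ} (R : CommutativeSemiring c ℓ) where

  open import Data.Bool using (Bool; true; false; if_then_else_; _∧_)
  open import Data.List using (List; []; _∷_; map; foldr; _++_; concatMap)
  open import Data.List.Membership.Propositional using (_∈_)
  open import Data.List.Relation.Unary.Any using (here; there)
  open import Function using (_∘_; const)
  open import Relation.Binary.PropositionalEquality using (_≡_) renaming (refl to ≡-refl)
  open import Defs using (filterᵇ)

  open CommutativeSemiring R
  open import Algebra.Properties.CommutativeSemigroup +-commutativeSemigroup using (interchange)

  ∑ : {B : Set} → List B → (B → Carrier) → Carrier
  ∑ xs f = foldr _+_ 0# (map f xs)

  infixr 8 [_]·_

  [_]·_ : Bool → Carrier → Carrier
  [ b ]· x = if b then x else 0#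

  []·-0 : ∀ b → [ b ]· 0# ≈ 0#
  []·-0 true  = refl
  []·-0 false = refl

  []·-∧ : ∀ b c x → [ b ∧ c ]· x ≈ [ b ]· [ c ]· x
  []·-∧ true  c x = refl
  []·-∧ false c x = refl

  []·-comm : ∀ b c x → [ b ]· [ c ]· x ≈ [ c ]· [ b ]· x
  []·-comm true  c x = refl
  []·-comm false c x = sym ([]·-0 c)

  []·-+ : ∀ b x y → [ b ]· (x + y) ≈ [ b ]· x + [ b ]· y
  []·-+ true  x y = refl
  []·-+ false x y = sym (+-identityˡ 0#)

  *-[]· : ∀ b x y → x * [ b ]· y ≈ [ b ]· (x * y)
  *-[]· true  x y = refl
  *-[]· false x y = zeroʳ x

  []·-* : ∀ b x y → ([ b ]· x) * y ≈ [ b ]· (x * y)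
  []·-* true  x y = refl
  []·-* false x y = zeroˡ y

  []·1-* : ∀ b x → ([ b ]· 1#) * x ≈ [ b ]· x
  []·1-* true  x = *-identityˡ x
  []·1-* false x = zeroˡ x

  []·[]·1-* : ∀ a b x → ([ a ]· [ b ]· 1#) * x ≈ [ a ]· [ b ]· x
  []·[]·1-* true  b x = []·1-* b x
  []·[]·1-* false b x = zeroˡ x

  module _ {B : Set} where

    ∑-cong : ∀ (xs : List B) {f g : B → Carrier} → (∀ x → f x ≈ g x) → ∑ xs f ≈ ∑ xs g
    ∑-cong []       f≈g = refl
    ∑-cong (x ∷ xs) f≈g = +-cong (f≈g x) (∑-cong xs f≈g)

    ∑-cong-∈ : ∀ (xs : List B) {f g : B → Carrier} → (∀ {x} → x ∈ xs → f x ≈ g x) → ∑ xs f ≈ ∑ xs g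
    ∑-cong-∈ []       f≈g = refl
    ∑-cong-∈ (x ∷ xs) f≈g = +-cong (f≈g (here ≡-refl)) (∑-cong-∈ xs (f≈g ∘ there))

    ∑-zero : ∀ (xs : List B) → ∑ xs (const 0#) ≈ 0#
    ∑-zero []       = refl
    ∑-zero (x ∷ xs) = trans (+-identityˡ _) (∑-zero xs)

    ∑-++ : ∀ (xs ys : List B) (f : B → Carrier) → ∑ (xs ++ ys) f ≈ ∑ xs f + ∑ ys f
    ∑-++ []       ys f = sym (+-identityˡ _)
    ∑-++ (x ∷ xs) ys f = trans (+-congˡ (∑-++ xs ys f)) (sym (+-assoc _ _ _))

    ∑-distrib-+ : ∀ (xs : List B) (f g : B → Carrier) →
                  ∑ xs (λ x → f x + g x) ≈ ∑ xs f + ∑ xs g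
    ∑-distrib-+ []       f g = sym (+-identityˡ 0#)
    ∑-distrib-+ (x ∷ xs) f g = trans (+-congˡ (∑-distrib-+ xs f g)) (interchange _ _ _ _)

    *-distribˡ-∑ : ∀ a (xs : List B) (f : B → Carrier) → a * ∑ xs f ≈ ∑ xs (λ x → a * f x)
    *-distribˡ-∑ a []       f = zeroʳ a
    *-distribˡ-∑ a (x ∷ xs) f = trans (distribˡ a (f x) _) (+-congˡ (*-distribˡ-∑ a xs f))

    *-distribʳ-∑ : ∀ a (xs : List B) (f : B → Carrier) → ∑ xs f * a ≈ ∑ xs (λ x → f x * a)
    *-distribʳ-∑ a xs f =
      trans (*-comm _ a) (trans (*-distribˡ-∑ a xs f) (∑-cong xs (λ x → *-comm a (f x))))

    ∑-[]· : ∀ (xs : List B) b (f : B → Carrier) → ∑ xs (λ x → [ b ]· f x) ≈ [ b ]· ∑ xs f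
    ∑-[]· xs true  f = refl
    ∑-[]· xs false f = ∑-zero xs

    ∑-[]·-const : ∀ (xs : List B) (p : B → Bool) a → ∑ xs (λ x → [ p x ]· a) ≈ ∑ xs (λ x → [ p x ]· 1#) * a
    ∑-[]·-const xs p a = sym (trans (*-distribʳ-∑ a xs _) (∑-cong xs (λ x → []·1-* (p x) a)))

    ∑-[]·-cong : ∀ (xs : List B) (p : B → Bool) {f g : B → Carrier} →
                 (∀ x → p x ≡ true → f x ≈ g x) → ∑ xs (λ x → [ p x ]· f x) ≈ ∑ xs (λ x → [ p x ]· g x)
    ∑-[]·-cong xs p {f} {g} f≈g = ∑-cong xs pointwise
      where
      pointwise : ∀ x → [ p x ]· f x ≈ [ p x ]· g x
      pointwise x with p x in px
      ... | true  = f≈g x px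
      ... | false = refl

    ∑-filter : ∀ (p : B → Bool) (xs : List B) (f : B → Carrier) →
               ∑ (filterᵇ p xs) f ≈ ∑ xs (λ x → [ p x ]· f x)
    ∑-filter p []       f = refl
    ∑-filter p (x ∷ xs) f with p x
    ... | true  = +-congˡ (∑-filter p xs f)
    ... | false = trans (∑-filter p xs f) (sym (+-identityˡ _))

  module _ {B C : Set} where

    ∑-map : ∀ (g : B → C) (xs : List B) (f : C → Carrier) → ∑ (map g xs) f ≈ ∑ xs (f ∘ g)
    ∑-map g []       f = refl
    ∑-map g (x ∷ xs) f = +-congˡ (∑-map g xs f)

    ∑-concatMap : ∀ (g : B → List C) (xs : List B) (f : C → Carrier) →
                  ∑ (concatMap g xs) f ≈ ∑ xs (λ x → ∑ (g x) f)
    ∑-concatMap g []       f = refl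
    ∑-concatMap g (x ∷ xs) f = trans (∑-++ (g x) _ f) (+-congˡ (∑-concatMap g xs f))

    ∑-comm : ∀ (xs : List B) (ys : List C) (f : B → C → Carrier) →
             ∑ xs (λ x → ∑ ys (f x)) ≈ ∑ ys (λ y → ∑ xs (λ x → f x y))
    ∑-comm []       ys f = sym (∑-zero ys)
    ∑-comm (x ∷ xs) ys f = trans (+-congˡ (∑-comm xs ys f)) (sym (∑-distrib-+ ys (f x) _))

module Counting where

  open import Algebra.Bundles using (CommutativeMonoid)
  open import Data.Bool using (Bool; true; false; not; _∧_; _∨_)
  open import Data.Bool.Properties using (⇔→≡; T-≡; ∧-assoc; ∧-identityʳ; ∧-zeroʳ; ∧-commutativeMonoid)
  open import Data.Bool.ListAction using (all; and)
  open import Data.Empty using (⊥-elim)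
  open import Data.Fin as Fin using (Fin; zero; suc; toℕ; fromℕ<; _↑ˡ_; punchOut)
  import Data.Fin.Properties as Fin
  open import Data.Fin.Permutation as Permutation using (Permutation′; _⟨$⟩ʳ_; _⟨$⟩ˡ_; inverseˡ; inverseʳ; _∘ₚ_)
  import Data.Fin.Permutation.Components as PC
  open import Data.List using (List; []; _∷_; map; length; allFin)
  open import Data.List.Membership.Propositional using (_∈_; find; lose)
  open import Data.List.Membership.Propositional.Properties using (∈-allFin; ∈-map⁺; ∈-concatMap⁺)
  open import Data.List.Properties using (map-tabulate; map-cong)
  open import Data.List.Relation.Unary.All.Properties using (all⁺; all⁻; tabulate⁺; tabulate⁻)
  open import Data.List.Relation.Unary.Any as Any using (here; there)
  open import Data.List.Relation.Unary.Any.Properties using (any⁺; any⁻)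
  open import Data.Nat
    using (ℕ; zero; suc; pred; _+_; _*_; _∸_; _!; _≤_; _<_; _≤ᵇ_; _<ᵇ_; z≤n; s≤s; z<s; s<s; s<s⁻¹; s≤s⁻¹)
  open import Data.Nat.Combinatorics using (_C_; nCk+nC[k+1]≡[n+1]C[k+1]; [n-k]*[n-k-1]!≡[n-k]!)
  open import Data.Nat.Combinatorics.Base using (_P′_)
  open import Data.Nat.Combinatorics.Specification using (nP′k≡n[n∸1P′k∸1]; nP′n≡n!)
  open import Data.Nat.Properties
    using ( +-*-commutativeSemiring; *-commutativeSemigroup; +-assoc; +-comm; +-identityʳ; +-suc; *-identityˡ
          ; *-assoc; *-distribˡ-+; *-distribʳ-+; +-∸-assoc; ∸-+-assoc; m∸n+n≡m; m+n∸m≡n; m+[n∸m]≡n; 0∸n≡0; n∸n≡0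
          ; pred[m∸n]≡m∸[1+n]; m≤n⇒m∸n≡0; _≤?_; ≤-refl; ≤-trans; <-≤-trans; <-cmp; <-irrefl; <⇒≤; <⇒≱; ≰⇒>
          ; n<1+n; m<n⇒m<1+n; m≤n+m; m≤n⇒m≤1+n; ≤ᵇ⇒≤; ≤⇒≤ᵇ)
  open import Data.Product using (_×_; _,_; proj₁; proj₂; ∃-syntax; Σ-syntax)
  open import Data.Vec as Vec using (Vec; []; _∷_; lookup; tabulate; _++_)
  open import Data.Vec.Properties using (lookup∘tabulate; tabulate∘lookup; tabulate-cong; lookup-++ˡ; lookup-allFin)
  import Data.Vec.Properties as Vec
  open import Function using (_∘_; id; _⇔_; mk⇔; Equivalence; _↔_; Inverse; mk↔ₛ′)
  open import Function.Definitions using (Injective)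
  open import Relation.Binary.Core using (_Preserves_⟶_)
  open import Relation.Binary.Definitions using (DecidableEquality; tri<; tri≈; tri>)
  open import Relation.Binary.PropositionalEquality
  open import Relation.Nullary using (Dec; does; yes; no; map′; contradiction)
  open import Relation.Nullary.Decidable using (dec-true; dec-false; does-≡)
  open import Defs
    using ( _==_; _⇔ᵇ_; filterᵇ; allVecs; Perm; Sym; isInjective; increasing; isPattern; N
          ; fixedPoints; conjugate; conjClass; doubleSum)

  open import Algebra.Properties.CommutativeSemigroup (CommutativeMonoid.commutativeSemigroup ∧-commutativeMonoid)
    using () renaming (interchange to ∧-interchange)
  open import Algebra.Properties.CommutativeSemigroup *-commutativeSemigroup
    using (x∙yz≈y∙xz) renaming (interchange to *-interchange)

  open ListSum +-*-commutativeSemiring public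

  -- Enumerations

  length-filterᵇ : ∀ {B : Set} (p : B → Bool) (xs : List B) → length (filterᵇ p xs) ≡ ∑ xs (λ x → [ p x ]· 1)
  length-filterᵇ p []       = refl
  length-filterᵇ p (x ∷ xs) with p x
  ... | true  = cong suc (length-filterᵇ p xs)
  ... | false = length-filterᵇ p xs

  module Enumeration {B : Set} (_≟_ : DecidableEquality B) (xs : List B)
    (occurs-once : ∀ a → ∑ xs (λ x → [ does (x ≟ a) ]· 1) ≡ 1) where

    ∑-δ : ∀ a (f : B → ℕ) → ∑ xs (λ x → [ does (x ≟ a) ]· f x) ≡ f a
    ∑-δ a f = begin
      ∑ xs (λ x → [ does (x ≟ a) ]· f x)   ≡⟨ ∑-cong xs pick ⟩
      ∑ xs (λ x → [ does (x ≟ a) ]· 1 * f a) ≡⟨ *-distribʳ-∑ (f a) xs _ ⟨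
      ∑ xs (λ x → [ does (x ≟ a) ]· 1) * f a ≡⟨ cong (_* f a) (occurs-once a) ⟩
      1 * f a                               ≡⟨ +-identityʳ (f a) ⟩
      f a                                   ∎
      where
      open ≡-Reasoning
      pick : ∀ x → [ does (x ≟ a) ]· f x ≡ [ does (x ≟ a) ]· 1 * f a
      pick x with x ≟ a
      ... | yes refl = sym (+-identityʳ (f x))
      ... | no  _    = refl

    ∑-reindex : ∀ (h : B ↔ B) (f : B → ℕ) → ∑ xs (f ∘ Inverse.to h) ≡ ∑ xs f
    ∑-reindex h f = begin
      ∑ xs (λ x → f (to x))                              ≡⟨ ∑-cong xs (λ x → ∑-δ (to x) f) ⟨
      ∑ xs (λ x → ∑ xs (λ y → [ does (y ≟ to x) ]· f y)) ≡⟨ ∑-comm xs xs _ ⟩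
      ∑ xs (λ y → ∑ xs (λ x → [ does (y ≟ to x) ]· f y)) ≡⟨ ∑-cong xs (λ y → ∑-cong xs (λ x →
                                                               cong ([_]· f y) (transpose y x))) ⟩
      ∑ xs (λ y → ∑ xs (λ x → [ does (x ≟ from y) ]· f y)) ≡⟨ ∑-cong xs (λ y → ∑-δ (from y) (λ _ → f y)) ⟩
      ∑ xs f                                             ∎
      where
      open ≡-Reasoning
      open Inverse h using (to; from; strictlyInverseˡ; strictlyInverseʳ)
      transpose : ∀ y x → does (y ≟ to x) ≡ does (x ≟ from y)
      transpose y x = does-≡ (y ≟ to x) (map′ (λ x≡from-y → trans (sym (strictlyInverseˡ y)) (cong to (sym x≡from-y)))
                                              (λ y≡to-x → trans (sym (strictlyInverseʳ x)) (cong from (sym y≡to-x)))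
                                              (x ≟ from y))

  ∑-allFin-suc : ∀ n (f : Fin (suc n) → ℕ) → ∑ (allFin (suc n)) f ≡ f zero + ∑ (allFin n) (f ∘ suc)
  ∑-allFin-suc n f =
    cong (f zero +_) (trans (cong (λ ys → ∑ ys f) (sym (map-tabulate id suc))) (∑-map suc (allFin n) f))

  allFin-occurs-once : ∀ {n} (a : Fin n) → ∑ (allFin n) (λ x → [ does (x Fin.≟ a) ]· 1) ≡ 1
  allFin-occurs-once {suc n} a = trans (∑-allFin-suc n (λ x → [ does (x Fin.≟ a) ]· 1)) (count a)
    where
    count : ∀ a → [ does (zero Fin.≟ a) ]· 1 + ∑ (allFin n) (λ x → [ does (suc x Fin.≟ a) ]· 1) ≡ 1
    count zero    = cong suc (∑-zero (allFin n))
    count (suc a) = allFin-occurs-once a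

  ∑-allVecs-suc : ∀ n m (f : Vec (Fin n) (suc m) → ℕ) →
                  ∑ (allVecs n (suc m)) f ≡ ∑ (allFin n) (λ x → ∑ (allVecs n m) (λ w → f (x ∷ w)))
  ∑-allVecs-suc n m f =
    trans (∑-concatMap _ (allFin n) f) (∑-cong (allFin n) (λ x → ∑-map (x ∷_) (allVecs n m) f))

  allVecs-occurs-once : ∀ {n m} (a : Vec (Fin n) m) →
                        ∑ (allVecs n m) (λ v → [ does (Vec.≡-dec Fin._≟_ v a) ]· 1) ≡ 1
  allVecs-occurs-once []                     = refl
  allVecs-occurs-once {n} {suc m} (a ∷ as) = begin
    ∑ (allVecs n (suc m)) (λ v → [ does (Vec.≡-dec Fin._≟_ v (a ∷ as)) ]· 1)
      ≡⟨ ∑-allVecs-suc n m _ ⟩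
    ∑ (allFin n) (λ x → ∑ (allVecs n m) (λ w → [ does (x Fin.≟ a) ∧ does (Vec.≡-dec Fin._≟_ w as) ]· 1))
      ≡⟨ ∑-cong (allFin n) (λ x → trans (∑-cong (allVecs n m) (λ w → []·-∧ (does (x Fin.≟ a)) _ 1))
                                        (∑-[]· (allVecs n m) (does (x Fin.≟ a)) _)) ⟩
    ∑ (allFin n) (λ x → [ does (x Fin.≟ a) ]· ∑ (allVecs n m) (λ w → [ does (Vec.≡-dec Fin._≟_ w as) ]· 1))
      ≡⟨ ∑-cong (allFin n) (λ x → cong ([ does (x Fin.≟ a) ]·_) (allVecs-occurs-once as)) ⟩
    ∑ (allFin n) (λ x → [ does (x Fin.≟ a) ]· 1)
      ≡⟨ allFin-occurs-once a ⟩
    1 ∎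
    where open ≡-Reasoning

  module _ {n : ℕ} where
    open Enumeration (Fin._≟_ {n}) (allFin n) allFin-occurs-once public
      renaming (∑-δ to ∑-allFin-δ; ∑-reindex to ∑-allFin-reindex)

  module _ {n m : ℕ} where
    open Enumeration (Vec.≡-dec {n = m} (Fin._≟_ {n})) (allVecs n m) allVecs-occurs-once public
      using () renaming (∑-reindex to ∑-allVecs-reindex)

  all-allFin : ∀ {n} (p : Fin n → Bool) → all p (allFin n) ≡ true ⇔ (∀ i → p i ≡ true)
  all-allFin p = mk⇔
    (λ all≡ i → Equivalence.to T-≡ (tabulate⁻ (all⁺ p _ (Equivalence.from T-≡ all≡)) i))
    (λ p≡ → Equivalence.to T-≡ (all⁻ p (tabulate⁺ (Equivalence.from T-≡ ∘ p≡))))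

  all-cong : ∀ {B : Set} {p q : B → Bool} (xs : List B) → (∀ x → p x ≡ q x) → all p xs ≡ all q xs
  all-cong xs p≗q = cong and (map-cong p≗q xs)

  -- Vectors with distinct entries

  module _ {n : ℕ} where

    infix 4 _∉ᵇ_

    _∉ᵇ_ : ∀ {m} → Fin n → Vec (Fin n) m → Bool
    x ∉ᵇ []      = true
    x ∉ᵇ (y ∷ v) = not (x == y) ∧ (x ∉ᵇ v)

    distinct : ∀ {m} → Vec (Fin n) m → Bool
    distinct []      = true
    distinct (x ∷ v) = (x ∉ᵇ v) ∧ distinct v

    disjoint : ∀ {m r} → Vec (Fin n) m → Vec (Fin n) r → Bool
    disjoint []      w = true
    disjoint (x ∷ u) w = (x ∉ᵇ w) ∧ disjoint u w

    ∉ᵇ⁻ : ∀ {m x} (v : Vec (Fin n) m) → (x ∉ᵇ v) ≡ true → ∀ i → lookup v i ≢ x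
    ∉ᵇ⁻ {x = x} (y ∷ v) x∉v i with x Fin.≟ y
    ∉ᵇ⁻ (y ∷ v) x∉v zero    | no x≢y = x≢y ∘ sym
    ∉ᵇ⁻ (y ∷ v) x∉v (suc i) | no x≢y = ∉ᵇ⁻ v x∉v i

    ∉ᵇ⁺ : ∀ {m x} (v : Vec (Fin n) m) → (∀ i → lookup v i ≢ x) → (x ∉ᵇ v) ≡ true
    ∉ᵇ⁺         []      v≢x = refl
    ∉ᵇ⁺ {x = x} (y ∷ v) v≢x with x Fin.≟ y
    ... | yes refl = ⊥-elim (v≢x zero refl)
    ... | no  _    = ∉ᵇ⁺ v (v≢x ∘ suc)

    distinct⁻ : ∀ {m} (v : Vec (Fin n) m) → distinct v ≡ true → Injective _≡_ _≡_ (lookup v)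
    distinct⁻ (x ∷ v) d with x ∉ᵇ v in x∉v
    ... | true = injective
      where
      injective : Injective _≡_ _≡_ (lookup (x ∷ v))
      injective {zero}  {zero}  _  = refl
      injective {zero}  {suc j} eq = ⊥-elim (∉ᵇ⁻ v x∉v j (sym eq))
      injective {suc i} {zero}  eq = ⊥-elim (∉ᵇ⁻ v x∉v i eq)
      injective {suc i} {suc j} eq = cong suc (distinct⁻ v d eq)

    distinct⁺ : ∀ {m} (v : Vec (Fin n) m) → Injective _≡_ _≡_ (lookup v) → distinct v ≡ true
    distinct⁺ []      _         = refl
    distinct⁺ (x ∷ v) injective
      rewrite ∉ᵇ⁺ v (λ i vᵢ≡x → Fin.0≢1+n (injective (sym vᵢ≡x))) =
      distinct⁺ v (λ eq → Fin.suc-injective (injective eq))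

  isInjective≡distinct : ∀ {n} (v : Perm n) → isInjective v ≡ distinct v
  isInjective≡distinct {n} v = ⇔→≡ {z = true} (mk⇔
    (λ inj → distinct⁺ v (λ {i} {j} →
       Equivalence.to (pair i j) (Equivalence.to (all-allFin _) (Equivalence.to (all-allFin _) inj i) j)))
    (λ d → Equivalence.from (all-allFin _) (λ i → Equivalence.from (all-allFin _) (λ j →
             Equivalence.from (pair i j) (distinct⁻ v d)))))
    where
    pair : ∀ i j → ((i == j) ∨ not (lookup v i == lookup v j)) ≡ true ⇔ (lookup v i ≡ lookup v j → i ≡ j)
    pair i j with i Fin.≟ j
    ... | yes i≡j = mk⇔ (λ _ _ → i≡j) (λ _ → refl)
    ... | no  i≢j with lookup v i Fin.≟ lookup v j
    ...   | yes vᵢ≡vⱼ = mk⇔ (λ ()) (λ inj → ⊥-elim (i≢j (inj vᵢ≡vⱼ)))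
    ...   | no  vᵢ≢vⱼ = mk⇔ (λ _ vᵢ≡vⱼ → ⊥-elim (vᵢ≢vⱼ vᵢ≡vⱼ)) (λ _ → refl)

  ==⇔≡ : ∀ {n} {x y : Fin n} → (x == y) ≡ true ⇔ x ≡ y
  ==⇔≡ {x = x} {y} with x Fin.≟ y
  ... | yes x≡y = mk⇔ (λ _ → x≡y) (λ _ → refl)
  ... | no  x≢y = mk⇔ (λ ()) (λ x≡y → ⊥-elim (x≢y x≡y))

  ==-sym : ∀ {n} (x y : Fin n) → (x == y) ≡ (y == x)
  ==-sym x y = does-≡ (x Fin.≟ y) (map′ sym sym (y Fin.≟ x))

  ∑-allFin-1 : ∀ m → ∑ (allFin m) (λ _ → 1) ≡ m
  ∑-allFin-1 zero    = refl
  ∑-allFin-1 (suc m) = trans (∑-allFin-suc m (λ _ → 1)) (cong suc (∑-allFin-1 m))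

  module _ {n : ℕ} where

    ∑-∈ᵇ : ∀ {m} (u : Vec (Fin n) m) → distinct u ≡ true → (f : Fin n → ℕ) →
           ∑ (allFin n) (λ x → [ not (x ∉ᵇ u) ]· f x) ≡ ∑ (allFin m) (f ∘ lookup u)
    ∑-∈ᵇ []      _ f = ∑-zero (allFin n)
    ∑-∈ᵇ {suc m} (y ∷ u) d f with y ∉ᵇ u in y∉u
    ... | true = begin
      ∑ (allFin n) (λ x → [ not (x ∉ᵇ (y ∷ u)) ]· f x)              ≡⟨ ∑-cong (allFin n) split ⟩
      ∑ (allFin n) (λ x → [ x == y ]· f x + [ not (x ∉ᵇ u) ]· f x)   ≡⟨ ∑-distrib-+ (allFin n) _ _ ⟩
      ∑ (allFin n) (λ x → [ x == y ]· f x) + ∑ (allFin n) (λ x → [ not (x ∉ᵇ u) ]· f x)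
        ≡⟨ cong₂ _+_ (∑-allFin-δ y f) (∑-∈ᵇ u d f) ⟩
      f y + ∑ (allFin m) (f ∘ lookup u)                              ≡⟨ ∑-allFin-suc m (f ∘ lookup (y ∷ u)) ⟨
      ∑ (allFin (suc m)) (f ∘ lookup (y ∷ u))                        ∎
      where
      open ≡-Reasoning
      split : ∀ x → [ not (x ∉ᵇ (y ∷ u)) ]· f x ≡ [ x == y ]· f x + [ not (x ∉ᵇ u) ]· f x
      split x with x Fin.≟ y
      ... | yes refl rewrite y∉u = sym (+-identityʳ (f x))
      ... | no  _    = refl

    ∑-split-∉ᵇ : ∀ {m} (u : Vec (Fin n) m) → distinct u ≡ true → (f : Fin n → ℕ) →
                 ∑ (allFin n) f ≡ ∑ (allFin m) (f ∘ lookup u) + ∑ (allFin n) (λ x → [ x ∉ᵇ u ]· f x)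
    ∑-split-∉ᵇ u d f = begin
      ∑ (allFin n) f                                    ≡⟨ ∑-cong (allFin n) (λ x → split (x ∉ᵇ u) (f x)) ⟩
      ∑ (allFin n) (λ x → [ not (x ∉ᵇ u) ]· f x + [ x ∉ᵇ u ]· f x) ≡⟨ ∑-distrib-+ (allFin n) _ _ ⟩
      ∑ (allFin n) (λ x → [ not (x ∉ᵇ u) ]· f x) + rest            ≡⟨ cong (_+ rest) (∑-∈ᵇ u d f) ⟩
      ∑ (allFin _) (f ∘ lookup u) + rest                           ∎
      where
      open ≡-Reasoning
      rest = ∑ (allFin n) (λ x → [ x ∉ᵇ u ]· f x)
      split : ∀ b a → a ≡ [ not b ]· a + [ b ]· a
      split true  a = refl
      split false a = sym (+-identityʳ a)

    count-∉ᵇ : ∀ {m} (u : Vec (Fin n) m) → distinct u ≡ true → ∑ (allFin n) (λ x → [ x ∉ᵇ u ]· 1) ≡ n ∸ m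
    count-∉ᵇ {m} u d = begin
      c                                            ≡⟨ m+n∸m≡n m c ⟨
      m + c ∸ m                                    ≡⟨ cong (λ k → k + c ∸ m) (∑-allFin-1 m) ⟨
      ∑ (allFin m) (λ _ → 1) + c ∸ m               ≡⟨ cong (_∸ m) (∑-split-∉ᵇ u d (λ _ → 1)) ⟨
      ∑ (allFin n) (λ _ → 1) ∸ m                   ≡⟨ cong (_∸ m) (∑-allFin-1 n) ⟩
      n ∸ m                                        ∎
      where
      open ≡-Reasoning
      c = ∑ (allFin n) (λ x → [ x ∉ᵇ u ]· 1)

  -- Rearranging positions

  rearrange : ∀ {A : Set} {m N} → (Fin m → Fin N) → Vec A N → Vec A m
  rearrange r v = tabulate (lookup v ∘ r)

  module _ {A : Set} {m N : ℕ} where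

    lookup-rearrange : ∀ (r : Fin m → Fin N) (v : Vec A N) i → lookup (rearrange r v) i ≡ lookup v (r i)
    lookup-rearrange r v = lookup∘tabulate (lookup v ∘ r)

    rearrange-cong : ∀ {r s : Fin m → Fin N} (v : Vec A N) → (∀ i → r i ≡ s i) → rearrange r v ≡ rearrange s v
    rearrange-cong v r≗s = tabulate-cong (cong (lookup v) ∘ r≗s)

    rearrange-∘ : ∀ {M} (r : Fin M → Fin m) (s : Fin m → Fin N) (v : Vec A N) →
                  rearrange r (rearrange s v) ≡ rearrange (s ∘ r) v
    rearrange-∘ r s v = tabulate-cong (lookup-rearrange s v ∘ r)

  module _ {A : Set} {N : ℕ} where

    rearrange-inverse : ∀ (r s : Fin N → Fin N) → (∀ i → s (r i) ≡ i) → (v : Vec A N) →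
                        rearrange r (rearrange s v) ≡ v
    rearrange-inverse r s s∘r≗id v =
      trans (rearrange-∘ r s v) (trans (rearrange-cong v s∘r≗id) (tabulate∘lookup v))

    permute : Permutation′ N → Vec A N ↔ Vec A N
    permute ρ = mk↔ₛ′ (rearrange (ρ ⟨$⟩ʳ_)) (rearrange (ρ ⟨$⟩ˡ_))
      (rearrange-inverse _ _ (λ _ → inverseˡ ρ)) (rearrange-inverse _ _ (λ _ → inverseʳ ρ))

  ⟨$⟩ʳ-injective : ∀ {N} (ρ : Permutation′ N) → Injective _≡_ _≡_ (ρ ⟨$⟩ʳ_)
  ⟨$⟩ʳ-injective ρ {i} {j} ρi≡ρj = trans (sym (inverseˡ ρ)) (trans (cong (ρ ⟨$⟩ˡ_) ρi≡ρj) (inverseˡ ρ))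

  module _ {n m N : ℕ} where

    distinct-rearrange : ∀ {r : Fin m → Fin N} (v : Vec (Fin n) N) → Injective _≡_ _≡_ r →
                         distinct v ≡ true → distinct (rearrange r v) ≡ true
    distinct-rearrange {r} v r-inj d = distinct⁺ (rearrange r v) (λ {i} {j} eq →
      r-inj (distinct⁻ v d (trans (sym (lookup-rearrange r v i)) (trans eq (lookup-rearrange r v j)))))

    ∉ᵇ-rearrange : ∀ {x} (r : Fin m → Fin N) (v : Vec (Fin n) N) → (x ∉ᵇ v) ≡ true → (x ∉ᵇ rearrange r v) ≡ true
    ∉ᵇ-rearrange r v x∉v = ∉ᵇ⁺ (rearrange r v) (λ i → ∉ᵇ⁻ v x∉v (r i) ∘ trans (sym (lookup-rearrange r v i)))

  module _ {n N : ℕ} (ρ : Permutation′ N) where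

    distinct-permute : ∀ (v : Vec (Fin n) N) → distinct (rearrange (ρ ⟨$⟩ʳ_) v) ≡ distinct v
    distinct-permute v = ⇔→≡ {z = true} (mk⇔
      (λ d → subst (λ w → distinct w ≡ true) (rearrange-inverse (ρ ⟨$⟩ˡ_) (ρ ⟨$⟩ʳ_) (λ _ → inverseʳ ρ) v)
                   (distinct-rearrange (rearrange (ρ ⟨$⟩ʳ_) v) (⟨$⟩ʳ-injective (Permutation.flip ρ)) d))
      (distinct-rearrange v (⟨$⟩ʳ-injective ρ)))

    ∉ᵇ-permute : ∀ x (v : Vec (Fin n) N) → (x ∉ᵇ rearrange (ρ ⟨$⟩ʳ_) v) ≡ (x ∉ᵇ v)
    ∉ᵇ-permute x v = ⇔→≡ {z = true} (mk⇔
      (λ x∉ → subst (λ w → (x ∉ᵇ w) ≡ true) (rearrange-inverse (ρ ⟨$⟩ˡ_) (ρ ⟨$⟩ʳ_) (λ _ → inverseʳ ρ) v)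
                    (∉ᵇ-rearrange (ρ ⟨$⟩ˡ_) (rearrange (ρ ⟨$⟩ʳ_) v) x∉))
      (∉ᵇ-rearrange (ρ ⟨$⟩ʳ_) v))

  transpose-here : ∀ {N} (i j : Fin N) → PC.transpose i j i ≡ j
  transpose-here i j rewrite dec-true (i Fin.≟ i) refl = refl

  transpose-elsewhere : ∀ {N} {i j k : Fin N} → k ≢ i → k ≢ j → PC.transpose i j k ≡ k
  transpose-elsewhere {i = i} {j} {k} k≢i k≢j
    rewrite dec-false (k Fin.≟ i) k≢i | dec-false (k Fin.≟ j) k≢j = refl

  extend-injections : ∀ {m N} (f g : Fin m → Fin N) → Injective _≡_ _≡_ f → Injective _≡_ _≡_ g →
                      Σ[ ρ ∈ Permutation′ N ] (∀ i → ρ ⟨$⟩ʳ f i ≡ g i)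
  extend-injections {zero}  f g _     _     = Permutation.id , λ ()
  extend-injections {suc m} f g f-inj g-inj
    with ρ , ρf≗g ← extend-injections (f ∘ suc) (g ∘ suc) (Fin.suc-injective ∘ f-inj) (Fin.suc-injective ∘ g-inj)
    = ρ ∘ₚ Permutation.transpose (ρ ⟨$⟩ʳ f zero) (g zero) , agrees
    where
    agrees : ∀ i → PC.transpose (ρ ⟨$⟩ʳ f zero) (g zero) (ρ ⟨$⟩ʳ f i) ≡ g i
    agrees zero    = transpose-here (ρ ⟨$⟩ʳ f zero) (g zero)
    agrees (suc i) = trans (cong (PC.transpose _ _) (ρf≗g i)) (transpose-elsewhere
      (λ gᵢ≡ρf₀ → Fin.0≢1+n (sym (f-inj (⟨$⟩ʳ-injective ρ (trans (ρf≗g i) gᵢ≡ρf₀)))))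
      (λ gᵢ≡g₀ → Fin.0≢1+n (sym (g-inj gᵢ≡g₀))))

  -- Injective extensions

  P′-suc : ∀ a r → a P′ suc r ≡ a * (pred a P′ r)
  P′-suc zero    r rewrite 0∸n≡0 r = refl
  P′-suc (suc a) r = nP′k≡n[n∸1P′k∸1] (suc a) (suc r)

  ∑-allVecs-++ : ∀ n m r (f : Vec (Fin n) (m + r) → ℕ) →
                 ∑ (allVecs n (m + r)) f ≡ ∑ (allVecs n m) (λ u → ∑ (allVecs n r) (λ w → f (u ++ w)))
  ∑-allVecs-++ n zero    r f = sym (+-identityʳ _)
  ∑-allVecs-++ n (suc m) r f = trans (∑-allVecs-suc n (m + r) f)
    (trans (∑-cong (allFin n) (λ x → ∑-allVecs-++ n m r (f ∘ (x ∷_)))) (sym (∑-allVecs-suc n m _)))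

  module _ {n : ℕ} where

    ∉ᵇ-++ : ∀ {m r} (x : Fin n) (u : Vec (Fin n) m) (w : Vec (Fin n) r) →
            (x ∉ᵇ u ++ w) ≡ (x ∉ᵇ u) ∧ (x ∉ᵇ w)
    ∉ᵇ-++ x []      w = refl
    ∉ᵇ-++ x (y ∷ u) w = trans (cong (not (x == y) ∧_) (∉ᵇ-++ x u w)) (sym (∧-assoc (not (x == y)) _ _))

    distinct-++ : ∀ {m r} (u : Vec (Fin n) m) (w : Vec (Fin n) r) →
                  distinct (u ++ w) ≡ distinct u ∧ (disjoint u w ∧ distinct w)
    distinct-++ []      w = refl
    distinct-++ (x ∷ u) w = begin
      (x ∉ᵇ u ++ w) ∧ distinct (u ++ w)
        ≡⟨ cong₂ _∧_ (∉ᵇ-++ x u w) (distinct-++ u w) ⟩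
      ((x ∉ᵇ u) ∧ (x ∉ᵇ w)) ∧ (distinct u ∧ (disjoint u w ∧ distinct w))
        ≡⟨ ∧-interchange (x ∉ᵇ u) (x ∉ᵇ w) (distinct u) (disjoint u w ∧ distinct w) ⟩
      ((x ∉ᵇ u) ∧ distinct u) ∧ ((x ∉ᵇ w) ∧ (disjoint u w ∧ distinct w))
        ≡⟨ cong (((x ∉ᵇ u) ∧ distinct u) ∧_) (∧-assoc (x ∉ᵇ w) (disjoint u w) (distinct w)) ⟨
      ((x ∉ᵇ u) ∧ distinct u) ∧ (((x ∉ᵇ w) ∧ disjoint u w) ∧ distinct w) ∎
      where open ≡-Reasoning

    disjoint-[] : ∀ {m} (u : Vec (Fin n) m) → disjoint u [] ≡ true
    disjoint-[] []      = refl
    disjoint-[] (x ∷ u) = disjoint-[] u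

    disjoint-∷ʳ : ∀ {m r} (u : Vec (Fin n) m) (y : Fin n) (w : Vec (Fin n) r) →
                  disjoint u (y ∷ w) ≡ (y ∉ᵇ u) ∧ disjoint u w
    disjoint-∷ʳ []      y w = refl
    disjoint-∷ʳ (x ∷ u) y w = begin
      (not (x == y) ∧ (x ∉ᵇ w)) ∧ disjoint u (y ∷ w)
        ≡⟨ cong₂ (λ b c → (not b ∧ (x ∉ᵇ w)) ∧ c) (==-sym x y) (disjoint-∷ʳ u y w) ⟩
      (not (y == x) ∧ (x ∉ᵇ w)) ∧ ((y ∉ᵇ u) ∧ disjoint u w)
        ≡⟨ ∧-interchange (not (y == x)) (x ∉ᵇ w) (y ∉ᵇ u) (disjoint u w) ⟩
      (not (y == x) ∧ (y ∉ᵇ u)) ∧ ((x ∉ᵇ w) ∧ disjoint u w) ∎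
      where open ≡-Reasoning

    count-distinct-disjoint : ∀ {m} r (u : Vec (Fin n) m) → distinct u ≡ true →
      ∑ (allVecs n r) (λ w → [ disjoint u w ∧ distinct w ]· 1) ≡ (n ∸ m) P′ r
    count-distinct-disjoint zero    u _ rewrite disjoint-[] u = refl
    count-distinct-disjoint {m} (suc r) u d = begin
      ∑ (allVecs n (suc r)) (λ w → [ disjoint u w ∧ distinct w ]· 1)
        ≡⟨ ∑-allVecs-suc n r _ ⟩
      ∑ (allFin n) (λ y → ∑ (allVecs n r) (λ w → [ disjoint u (y ∷ w) ∧ ((y ∉ᵇ w) ∧ distinct w) ]· 1))
        ≡⟨ ∑-cong (allFin n) (λ y → trans (∑-cong (allVecs n r) (λ w → regroup y w))
                                          (∑-[]· (allVecs n r) (y ∉ᵇ u) _)) ⟩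
      ∑ (allFin n) (λ y → [ y ∉ᵇ u ]· ∑ (allVecs n r) (λ w → [ disjoint (y ∷ u) w ∧ distinct w ]· 1))
        ≡⟨ ∑-[]·-cong (allFin n) (_∉ᵇ u) (λ y y∉u →
             trans (count-distinct-disjoint r (y ∷ u) (cong₂ _∧_ y∉u d))
                   (cong (_P′ r) (sym (pred[m∸n]≡m∸[1+n] n m)))) ⟩
      ∑ (allFin n) (λ y → [ y ∉ᵇ u ]· (pred (n ∸ m) P′ r))
        ≡⟨ ∑-[]·-const (allFin n) (_∉ᵇ u) (pred (n ∸ m) P′ r) ⟩
      ∑ (allFin n) (λ y → [ y ∉ᵇ u ]· 1) * (pred (n ∸ m) P′ r)
        ≡⟨ cong (_* (pred (n ∸ m) P′ r)) (count-∉ᵇ u d) ⟩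
      (n ∸ m) * (pred (n ∸ m) P′ r)
        ≡⟨ P′-suc (n ∸ m) r ⟨
      (n ∸ m) P′ suc r ∎
      where
      open ≡-Reasoning
      regroup : ∀ y w → [ disjoint u (y ∷ w) ∧ ((y ∉ᵇ w) ∧ distinct w) ]· 1
                      ≡ [ y ∉ᵇ u ]· [ ((y ∉ᵇ w) ∧ disjoint u w) ∧ distinct w ]· 1
      regroup y w rewrite disjoint-∷ʳ u y w with y ∉ᵇ u | disjoint u w
      ... | false | _     = refl
      ... | true  | true  = cong ([_]· 1) (cong (_∧ distinct w) (sym (∧-identityʳ (y ∉ᵇ w))))
      ... | true  | false = cong ([_]· 1) (cong (_∧ distinct w) (sym (∧-zeroʳ (y ∉ᵇ w))))

    rearrange-↑ˡ-++ : ∀ {m r} (u : Vec (Fin n) m) (w : Vec (Fin n) r) → rearrange (_↑ˡ r) (u ++ w) ≡ u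
    rearrange-↑ˡ-++ u w = trans (tabulate-cong (lookup-++ˡ u w)) (tabulate∘lookup u)

    ∑-distinct-++ : ∀ m r (g : Vec (Fin n) m → ℕ) →
      ∑ (allVecs n (m + r)) (λ v → [ distinct v ]· g (rearrange (_↑ˡ r) v))
        ≡ ((n ∸ m) P′ r) * ∑ (allVecs n m) (λ u → [ distinct u ]· g u)
    ∑-distinct-++ m r g = begin
      ∑ (allVecs n (m + r)) (λ v → [ distinct v ]· g (rearrange (_↑ˡ r) v))
        ≡⟨ ∑-allVecs-++ n m r _ ⟩
      ∑ (allVecs n m) (λ u → ∑ (allVecs n r) (λ w → [ distinct (u ++ w) ]· g (rearrange (_↑ˡ r) (u ++ w))))
        ≡⟨ ∑-cong (allVecs n m) (λ u → ∑-cong (allVecs n r) (λ w →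
             cong₂ [_]·_ (distinct-++ u w) (cong g (rearrange-↑ˡ-++ u w)))) ⟩
      ∑ (allVecs n m) (λ u → ∑ (allVecs n r) (λ w → [ distinct u ∧ (disjoint u w ∧ distinct w) ]· g u))
        ≡⟨ ∑-cong (allVecs n m) (λ u → trans (∑-cong (allVecs n r) (λ w → []·-∧ (distinct u) _ (g u)))
                                             (∑-[]· (allVecs n r) (distinct u) _)) ⟩
      ∑ (allVecs n m) (λ u → [ distinct u ]· ∑ (allVecs n r) (λ w → [ disjoint u w ∧ distinct w ]· g u))
        ≡⟨ ∑-[]·-cong (allVecs n m) distinct extensions ⟩
      ∑ (allVecs n m) (λ u → [ distinct u ]· (((n ∸ m) P′ r) * g u))
        ≡⟨ ∑-cong (allVecs n m) (λ u → sym (*-[]· (distinct u) ((n ∸ m) P′ r) (g u))) ⟩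
      ∑ (allVecs n m) (λ u → ((n ∸ m) P′ r) * [ distinct u ]· g u)
        ≡⟨ *-distribˡ-∑ ((n ∸ m) P′ r) (allVecs n m) (λ u → [ distinct u ]· g u) ⟨
      ((n ∸ m) P′ r) * ∑ (allVecs n m) (λ u → [ distinct u ]· g u) ∎
      where
      open ≡-Reasoning
      extensions : ∀ u → distinct u ≡ true →
                   ∑ (allVecs n r) (λ w → [ disjoint u w ∧ distinct w ]· g u) ≡ ((n ∸ m) P′ r) * g u
      extensions u d = begin
        ∑ (allVecs n r) (λ w → [ disjoint u w ∧ distinct w ]· g u)
          ≡⟨ ∑-[]·-const (allVecs n r) (λ w → disjoint u w ∧ distinct w) (g u) ⟩
        ∑ (allVecs n r) (λ w → [ disjoint u w ∧ distinct w ]· 1) * g u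
          ≡⟨ cong (_* g u) (count-distinct-disjoint r u d) ⟩
        ((n ∸ m) P′ r) * g u ∎

    -- Permuting positions moves p to the front; each injective u then has (n ∸ m) P′ (N ∸ m) injective
    -- extensions.
    ∑-distinct-restrict : ∀ {N m} (p : Vec (Fin N) m) → distinct p ≡ true → (g : Vec (Fin n) m → ℕ) →
      ∑ (allVecs n N) (λ π → [ distinct π ]· g (rearrange (lookup p) π))
        ≡ ((n ∸ m) P′ (N ∸ m)) * ∑ (allVecs n m) (λ u → [ distinct u ]· g u)
    ∑-distinct-restrict {N} {m} p d g
      with r ← N ∸ m | refl ← m+[n∸m]≡n (Fin.injective⇒≤ (distinct⁻ p d)) = begin
      ∑ (allVecs n (m + r)) F
        ≡⟨ ∑-allVecs-reindex (permute ρ) F ⟨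
      ∑ (allVecs n (m + r)) (λ π → F (rearrange (ρ ⟨$⟩ʳ_) π))
        ≡⟨ ∑-cong (allVecs n (m + r)) (λ π → cong₂ [_]·_ (distinct-permute ρ π) (cong g (
             trans (rearrange-∘ (lookup p) (ρ ⟨$⟩ʳ_) π) (rearrange-cong π ρp≗↑ˡ)))) ⟩
      ∑ (allVecs n (m + r)) (λ π → [ distinct π ]· g (rearrange (_↑ˡ r) π))
        ≡⟨ ∑-distinct-++ m r g ⟩
      ((n ∸ m) P′ r) * ∑ (allVecs n m) (λ u → [ distinct u ]· g u) ∎
      where
      open ≡-Reasoning
      F : Vec (Fin n) (m + r) → ℕ
      F π = [ distinct π ]· g (rearrange (lookup p) π)
      ρ-ext = extend-injections (lookup p) (_↑ˡ r) (distinct⁻ p d) (λ {i} {j} → Fin.↑ˡ-injective r i j)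
      ρ = proj₁ ρ-ext
      ρp≗↑ˡ = proj₂ ρ-ext

  -- Sums over ranges

  m∸n∸1≡m∸[1+n] : ∀ m n → m ∸ n ∸ 1 ≡ m ∸ suc n
  m∸n∸1≡m∸[1+n] m n = trans (∸-+-assoc m n 1) (cong (m ∸_) (+-comm n 1))

  ≤⇒≤ᵇ≡true : ∀ {m n} → m ≤ n → (m ≤ᵇ n) ≡ true
  ≤⇒≤ᵇ≡true = Equivalence.to T-≡ ∘ ≤⇒≤ᵇ

  >⇒≤ᵇ≡false : ∀ {m n} → n < m → (m ≤ᵇ n) ≡ false
  >⇒≤ᵇ≡false {m} {n} n<m with m ≤ᵇ n in m≤ᵇn
  ... | false = refl
  ... | true  = ⊥-elim (<⇒≱ n<m (≤ᵇ⇒≤ m n (Equivalence.from T-≡ m≤ᵇn)))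

  ≥⇒<ᵇ≡false : ∀ {m n} → n ≤ m → (m <ᵇ n) ≡ false
  ≥⇒<ᵇ≡false n≤m = >⇒≤ᵇ≡false (s≤s n≤m)

  ≤ᵇ≡true⇒≤ : ∀ {m n} → (m ≤ᵇ n) ≡ true → m ≤ n
  ≤ᵇ≡true⇒≤ {m} {n} = ≤ᵇ⇒≤ m n ∘ Equivalence.from T-≡

  ≤ᵇ≡false⇒> : ∀ {m n} → (m ≤ᵇ n) ≡ false → n < m
  ≤ᵇ≡false⇒> {m} {n} m≰ᵇn with m ≤? n
  ... | yes m≤n = contradiction (trans (sym (≤⇒≤ᵇ≡true m≤n)) m≰ᵇn) λ ()
  ... | no  m≰n = ≰⇒> m≰n

  inRange : ℕ → ℕ → ℕ → Bool
  inRange lo hi i = (lo ≤ᵇ i) ∧ (i <ᵇ hi)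

  ∑-range : ∀ n → ℕ → ℕ → (Fin n → ℕ) → ℕ
  ∑-range n lo hi g = ∑ (allFin n) (λ x → [ inRange lo hi (toℕ x) ]· g x)

  module _ {n : ℕ} where

    ∑-range-empty : ∀ {lo hi} (g : Fin n → ℕ) → hi ≤ lo → ∑-range n lo hi g ≡ 0
    ∑-range-empty {lo} {hi} g hi≤lo = trans (∑-cong (allFin n) outside) (∑-zero (allFin n))
      where
      outside : ∀ x → [ inRange lo hi (toℕ x) ]· g x ≡ 0
      outside x with lo ≤ᵇ toℕ x in lo≤x
      ... | false = refl
      ... | true rewrite >⇒≤ᵇ≡false (≤-trans (s≤s hi≤lo) (s≤s (≤ᵇ≡true⇒≤ lo≤x))) = refl

    ∑-range-peel : ∀ {lo hi} (g : Fin n → ℕ) (lo<hi : lo < hi) (hi≤n : hi ≤ n) →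
                   ∑-range n lo hi g ≡ g (fromℕ< (<-≤-trans lo<hi hi≤n)) + ∑-range n (suc lo) hi g
    ∑-range-peel {lo} {hi} g lo<hi hi≤n = begin
      ∑-range n lo hi g
        ≡⟨ ∑-cong (allFin n) split ⟩
      ∑ (allFin n) (λ x → [ does-lo x ]· g x + [ inRange (suc lo) hi (toℕ x) ]· g x)
        ≡⟨ ∑-distrib-+ (allFin n) _ _ ⟩
      ∑ (allFin n) (λ x → [ does-lo x ]· g x) + ∑-range n (suc lo) hi g
        ≡⟨ cong (_+ ∑-range n (suc lo) hi g) (∑-allFin-δ a g) ⟩
      g a + ∑-range n (suc lo) hi g ∎
      where
      open ≡-Reasoning
      a = fromℕ< (<-≤-trans lo<hi hi≤n)
      does-lo = λ x → does (x Fin.≟ a)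
      split : ∀ x → [ inRange lo hi (toℕ x) ]· g x ≡ [ does-lo x ]· g x + [ inRange (suc lo) hi (toℕ x) ]· g x
      split x with x Fin.≟ a
      ... | yes refl rewrite Fin.toℕ-fromℕ< (<-≤-trans lo<hi hi≤n)
                           | ≤⇒≤ᵇ≡true (≤-refl {lo}) | ≤⇒≤ᵇ≡true lo<hi | >⇒≤ᵇ≡false (n<1+n lo) = sym (+-identityʳ (g x))
      ... | no  x≢a with <-cmp (toℕ x) lo
      ...   | tri< x<lo _ _ rewrite >⇒≤ᵇ≡false x<lo | >⇒≤ᵇ≡false (m<n⇒m<1+n x<lo) = refl
      ...   | tri≈ _ x≡lo _ = ⊥-elim (x≢a (Fin.toℕ-injective (trans x≡lo (sym (Fin.toℕ-fromℕ< _)))))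
      ...   | tri> _ _ lo<x rewrite ≤⇒≤ᵇ≡true (<⇒≤ lo<x) | ≤⇒≤ᵇ≡true lo<x = refl

    ∑-range-telescope : ∀ {lo hi} (g : Fin n → ℕ) (F : ℕ → ℕ) → lo ≤ hi → hi ≤ n →
                        (∀ x → lo ≤ toℕ x → toℕ x < hi → g x + F (suc (toℕ x)) ≡ F (toℕ x)) →
                        ∑-range n lo hi g + F hi ≡ F lo
    ∑-range-telescope {lo₀} {hi} g F lo₀≤hi hi≤n step = go (hi ∸ lo₀) lo₀ ≤-refl (m∸n+n≡m lo₀≤hi)
      where
      go : ∀ d lo → lo₀ ≤ lo → d + lo ≡ hi → ∑-range n lo hi g + F hi ≡ F lo
      go zero    lo _      refl = cong (_+ F lo) (∑-range-empty {lo} {lo} g ≤-refl)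
      go (suc d) lo lo₀≤lo refl = begin
        ∑-range n lo hi g + F hi                 ≡⟨ cong (_+ F hi) (∑-range-peel g lo<hi hi≤n) ⟩
        g a + ∑-range n (suc lo) hi g + F hi     ≡⟨ +-assoc (g a) _ (F hi) ⟩
        g a + (∑-range n (suc lo) hi g + F hi)   ≡⟨ cong (g a +_) (go d (suc lo) (m≤n⇒m≤1+n lo₀≤lo) (+-suc d lo)) ⟩
        g a + F (suc lo)                         ≡⟨ subst (λ i → g a + F (suc i) ≡ F i) toℕa≡lo
                                                      (step a (subst (lo₀ ≤_) (sym toℕa≡lo) lo₀≤lo)
                                                              (subst (_< hi) (sym toℕa≡lo) lo<hi)) ⟩
        F lo                                     ∎
        where
        open ≡-Reasoning
        lo<hi : lo < suc d + lo
        lo<hi = s≤s (m≤n+m lo d)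
        a = fromℕ< (<-≤-trans lo<hi hi≤n)
        toℕa≡lo : toℕ a ≡ lo
        toℕa≡lo = Fin.toℕ-fromℕ< _

    ∑-range-hockey-stick : ∀ lo {hi} r → hi ≤ n →
                           ∑-range n lo hi (λ x → (hi ∸ suc (toℕ x)) C r) ≡ (hi ∸ lo) C suc r
    ∑-range-hockey-stick lo {hi} r hi≤n with lo ≤? hi
    ... | no  lo≰hi rewrite m≤n⇒m∸n≡0 (<⇒≤ (≰⇒> lo≰hi)) =
      ∑-range-empty (λ x → (hi ∸ suc (toℕ x)) C r) (<⇒≤ (≰⇒> lo≰hi))
    ... | yes lo≤hi = begin
      ∑-range n lo hi g                         ≡⟨ +-identityʳ (∑-range n lo hi g) ⟨
      ∑-range n lo hi g + 0                     ≡⟨ cong (λ k → ∑-range n lo hi g + k C suc r) (n∸n≡0 hi) ⟨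
      ∑-range n lo hi g + (hi ∸ hi) C suc r     ≡⟨ ∑-range-telescope g (λ i → (hi ∸ i) C suc r) lo≤hi hi≤n pascal ⟩
      (hi ∸ lo) C suc r                         ∎
      where
      open ≡-Reasoning
      g : Fin n → ℕ
      g x = (hi ∸ suc (toℕ x)) C r
      pascal : ∀ x → lo ≤ toℕ x → toℕ x < hi → g x + (hi ∸ suc (toℕ x)) C suc r ≡ (hi ∸ toℕ x) C suc r
      pascal x _ x<hi = trans (nCk+nC[k+1]≡[n+1]C[k+1] (hi ∸ suc (toℕ x)) r)
                              (cong (_C suc r) (sym (+-∸-assoc 1 x<hi)))

    inRange-below : ∀ lo {i} → i < n → inRange lo n i ≡ (lo ≤ᵇ i)
    inRange-below lo i<n rewrite ≤⇒≤ᵇ≡true i<n = ∧-identityʳ _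

    ∑-range-cong : ∀ lo hi {g h : Fin n → ℕ} → (∀ x → g x ≡ h x) → ∑-range n lo hi g ≡ ∑-range n lo hi h
    ∑-range-cong lo hi g≗h = ∑-cong (allFin n) (λ x → cong ([ inRange lo hi (toℕ x) ]·_) (g≗h x))

    ∑-range-*ʳ : ∀ lo hi (g : Fin n → ℕ) K → ∑-range n lo hi (λ x → g x * K) ≡ ∑-range n lo hi g * K
    ∑-range-*ʳ lo hi g K = trans (∑-cong (allFin n) (λ x → sym ([]·-* (inRange lo hi (toℕ x)) (g x) K)))
                                 (sym (*-distribʳ-∑ K (allFin n) _))

    -- Increasing vectors

    increasingFrom : ∀ {m} → ℕ → Vec (Fin n) m → Bool
    increasingFrom lo []      = true
    increasingFrom lo (x ∷ w) = (lo ≤ᵇ toℕ x) ∧ increasingFrom (suc (toℕ x)) w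

    ∑-increasingFrom-∷ : ∀ {m} lo (h : Vec (Fin n) (suc m) → ℕ) →
      ∑ (allVecs n (suc m)) (λ w → [ increasingFrom lo w ]· h w)
        ≡ ∑-range n lo n (λ x → ∑ (allVecs n m) (λ w → [ increasingFrom (suc (toℕ x)) w ]· h (x ∷ w)))
    ∑-increasingFrom-∷ {m} lo h = trans (∑-allVecs-suc n m _) (∑-cong (allFin n) (λ x →
      trans (∑-cong (allVecs n m) (λ w → []·-∧ (lo ≤ᵇ toℕ x) _ (h (x ∷ w))))
     (trans (∑-[]· (allVecs n m) (lo ≤ᵇ toℕ x) _)
            (cong ([_]· _) (sym (inRange-below lo (Fin.toℕ<n x)))))))

    count-increasingFrom : ∀ m lo → ∑ (allVecs n m) (λ w → [ increasingFrom lo w ]· 1) ≡ (n ∸ lo) C m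
    count-increasingFrom zero    lo = refl
    count-increasingFrom (suc m) lo = begin
      ∑ (allVecs n (suc m)) (λ w → [ increasingFrom lo w ]· 1)
        ≡⟨ ∑-increasingFrom-∷ lo (λ _ → 1) ⟩
      ∑-range n lo n (λ x → ∑ (allVecs n m) (λ w → [ increasingFrom (suc (toℕ x)) w ]· 1))
        ≡⟨ ∑-range-cong lo n (λ x → count-increasingFrom m (suc (toℕ x))) ⟩
      ∑-range n lo n (λ x → (n ∸ suc (toℕ x)) C m)
        ≡⟨ ∑-range-hockey-stick lo m ≤-refl ⟩
      (n ∸ lo) C suc m ∎
      where open ≡-Reasoning

    count-increasingFrom-at : ∀ m (r : Fin m) lo (y : Fin n) →
      ∑ (allVecs n m) (λ w → [ increasingFrom lo w ]· [ lookup w r == y ]· 1)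
        ≡ [ lo ≤ᵇ toℕ y ]· (((toℕ y ∸ lo) C toℕ r) * ((n ∸ suc (toℕ y)) C (m ∸ suc (toℕ r))))
    count-increasingFrom-at (suc m) zero lo y = begin
      ∑ (allVecs n (suc m)) (λ w → [ increasingFrom lo w ]· [ lookup w zero == y ]· 1)
        ≡⟨ ∑-increasingFrom-∷ lo (λ w → [ lookup w zero == y ]· 1) ⟩
      ∑-range n lo n (λ x → ∑ (allVecs n m) (λ w → [ increasingFrom (suc (toℕ x)) w ]· [ x == y ]· 1))
        ≡⟨ ∑-range-cong lo n (λ x → trans (∑-cong (allVecs n m) (λ w → []·-comm (increasingFrom (suc (toℕ x)) w) (x == y) 1))
                                    (trans (∑-[]· (allVecs n m) (x == y) _)
                                           (cong ([ x == y ]·_) (count-increasingFrom m (suc (toℕ x)))))) ⟩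
      ∑-range n lo n (λ x → [ x == y ]· ((n ∸ suc (toℕ x)) C m))
        ≡⟨ ∑-cong (allFin n) (λ x → []·-comm (inRange lo n (toℕ x)) (x == y) _) ⟩
      ∑ (allFin n) (λ x → [ x == y ]· [ inRange lo n (toℕ x) ]· ((n ∸ suc (toℕ x)) C m))
        ≡⟨ ∑-allFin-δ y _ ⟩
      [ inRange lo n (toℕ y) ]· ((n ∸ suc (toℕ y)) C m)
        ≡⟨ cong₂ [_]·_ (inRange-below lo (Fin.toℕ<n y)) (sym (+-identityʳ _)) ⟩
      [ lo ≤ᵇ toℕ y ]· (((toℕ y ∸ lo) C 0) * ((n ∸ suc (toℕ y)) C m)) ∎
      where open ≡-Reasoning
    count-increasingFrom-at (suc m) (suc r) lo y = begin
      ∑ (allVecs n (suc m)) (λ w → [ increasingFrom lo w ]· [ lookup w (suc r) == y ]· 1)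
        ≡⟨ ∑-increasingFrom-∷ lo (λ w → [ lookup w (suc r) == y ]· 1) ⟩
      ∑-range n lo n (λ x → ∑ (allVecs n m) (λ w → [ increasingFrom (suc (toℕ x)) w ]· [ lookup w r == y ]· 1))
        ≡⟨ ∑-range-cong lo n (λ x → count-increasingFrom-at m r (suc (toℕ x)) y) ⟩
      ∑-range n lo n (λ x → [ toℕ x <ᵇ toℕ y ]· (((toℕ y ∸ suc (toℕ x)) C toℕ r) * K))
        ≡⟨ ∑-cong (allFin n) (λ x → trans (cong ([_]· [ toℕ x <ᵇ toℕ y ]· (((toℕ y ∸ suc (toℕ x)) C toℕ r) * K))
                                                (inRange-below lo (Fin.toℕ<n x)))
                                          (sym ([]·-∧ (lo ≤ᵇ toℕ x) (toℕ x <ᵇ toℕ y)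
                                                      (((toℕ y ∸ suc (toℕ x)) C toℕ r) * K)))) ⟩
      ∑-range n lo (toℕ y) (λ x → ((toℕ y ∸ suc (toℕ x)) C toℕ r) * K)
        ≡⟨ ∑-range-*ʳ lo (toℕ y) (λ x → (toℕ y ∸ suc (toℕ x)) C toℕ r) K ⟩
      ∑-range n lo (toℕ y) (λ x → (toℕ y ∸ suc (toℕ x)) C toℕ r) * K
        ≡⟨ cong (_* K) (∑-range-hockey-stick lo (toℕ r) (<⇒≤ (Fin.toℕ<n y))) ⟩
      ((toℕ y ∸ lo) C suc (toℕ r)) * K
        ≡⟨ vanishes-below (lo ≤ᵇ toℕ y) refl ⟩
      [ lo ≤ᵇ toℕ y ]· (((toℕ y ∸ lo) C suc (toℕ r)) * K) ∎
      where
      open ≡-Reasoning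
      K = (n ∸ suc (toℕ y)) C (m ∸ suc (toℕ r))
      vanishes-below : ∀ b → (lo ≤ᵇ toℕ y) ≡ b →
                       ((toℕ y ∸ lo) C suc (toℕ r)) * K ≡ [ b ]· (((toℕ y ∸ lo) C suc (toℕ r)) * K)
      vanishes-below true  _     = refl
      vanishes-below false lo≰ᵇy =
        cong (λ i → (i C suc (toℕ r)) * K) (m≤n⇒m∸n≡0 (<⇒≤ (≤ᵇ≡false⇒> {lo} {toℕ y} lo≰ᵇy)))

    available : ℕ → Fin n → ℕ
    available lo y = n ∸ lo ∸ [ lo ≤ᵇ toℕ y ]· 1

    available-≥n : ∀ {lo} (y : Fin n) → n ≤ lo → available lo y ≡ 0
    available-≥n {lo} y n≤lo = trans (cong (_∸ [ lo ≤ᵇ toℕ y ]· 1) (m≤n⇒m∸n≡0 n≤lo)) (0∸n≡0 ([ lo ≤ᵇ toℕ y ]· 1))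

    available-at : ∀ (y : Fin n) → available (toℕ y) y ≡ available (suc (toℕ y)) y
    available-at y rewrite ≤⇒≤ᵇ≡true (≤-refl {toℕ y}) | >⇒≤ᵇ≡false (n<1+n (toℕ y)) = m∸n∸1≡m∸[1+n] n (toℕ y)

    available-suc : ∀ {x y : Fin n} → y ≢ x → available (toℕ x) y ≡ suc (available (suc (toℕ x)) y)
    available-suc {x} {y} y≢x with <-cmp (toℕ x) (toℕ y)
    ... | tri< x<y _ _ rewrite ≤⇒≤ᵇ≡true (<⇒≤ x<y) | ≤⇒≤ᵇ≡true x<y = begin
      n ∸ toℕ x ∸ 1               ≡⟨ m∸n∸1≡m∸[1+n] n (toℕ x) ⟩
      n ∸ suc (toℕ x)             ≡⟨ +-∸-assoc 1 (<-≤-trans (s<s x<y) (Fin.toℕ<n y)) ⟩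
      suc (n ∸ suc (suc (toℕ x))) ≡⟨ cong suc (m∸n∸1≡m∸[1+n] n (suc (toℕ x))) ⟨
      suc (n ∸ suc (toℕ x) ∸ 1)   ∎
      where open ≡-Reasoning
    ... | tri≈ _ x≡y _ = ⊥-elim (y≢x (Fin.toℕ-injective (sym x≡y)))
    ... | tri> _ _ y<x rewrite >⇒≤ᵇ≡false y<x | >⇒≤ᵇ≡false (m<n⇒m<1+n y<x) = +-∸-assoc 1 (Fin.toℕ<n x)

    count-increasingFrom-∉ : ∀ m lo (y : Fin n) →
      ∑ (allVecs n m) (λ w → [ increasingFrom lo w ]· [ y ∉ᵇ w ]· 1) ≡ available lo y C m
    count-increasingFrom-∉ zero    lo y = refl
    count-increasingFrom-∉ (suc m) lo y = begin
      ∑ (allVecs n (suc m)) (λ w → [ increasingFrom lo w ]· [ y ∉ᵇ w ]· 1)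
        ≡⟨ ∑-increasingFrom-∷ lo (λ w → [ y ∉ᵇ w ]· 1) ⟩
      ∑-range n lo n (λ x → ∑ (allVecs n m) (λ w → [ increasingFrom (suc (toℕ x)) w ]· [ not (y == x) ∧ (y ∉ᵇ w) ]· 1))
        ≡⟨ ∑-range-cong lo n (λ x → trans (∑-cong (allVecs n m) (λ w →
               trans (cong ([ increasingFrom (suc (toℕ x)) w ]·_) ([]·-∧ (not (y == x)) (y ∉ᵇ w) 1))
                     ([]·-comm (increasingFrom (suc (toℕ x)) w) (not (y == x)) _)))
            (trans (∑-[]· (allVecs n m) (not (y == x)) _)
                   (cong ([ not (y == x) ]·_) (count-increasingFrom-∉ m (suc (toℕ x)) y)))) ⟩
      ∑-range n lo n g
        ≡⟨ telescope (lo ≤? n) ⟩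
      available lo y C suc m ∎
      where
      open ≡-Reasoning
      g : Fin n → ℕ
      g x = [ not (y == x) ]· (available (suc (toℕ x)) y C m)
      pascal : ∀ x → lo ≤ toℕ x → toℕ x < n →
               g x + available (suc (toℕ x)) y C suc m ≡ available (toℕ x) y C suc m
      pascal x _ _ with y Fin.≟ x
      ... | yes refl = cong (_C suc m) (sym (available-at y))
      ... | no  y≢x = trans (nCk+nC[k+1]≡[n+1]C[k+1] (available (suc (toℕ x)) y) m)
                            (cong (_C suc m) (sym (available-suc y≢x)))
      telescope : Dec (lo ≤ n) → ∑-range n lo n g ≡ available lo y C suc m
      telescope (no lo≰n) rewrite available-≥n y (<⇒≤ (≰⇒> lo≰n)) = ∑-range-empty g (<⇒≤ (≰⇒> lo≰n))
      telescope (yes lo≤n) = begin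
        ∑-range n lo n g                               ≡⟨ +-identityʳ (∑-range n lo n g) ⟨
        ∑-range n lo n g + 0                           ≡⟨ cong (λ a → ∑-range n lo n g + a C suc m) (available-≥n y ≤-refl) ⟨
        ∑-range n lo n g + available n y C suc m       ≡⟨ ∑-range-telescope g (λ i → available i y C suc m) lo≤n ≤-refl pascal ⟩
        available lo y C suc m                         ∎

    StrictlyIncreasing : ∀ {m} → Vec (Fin n) m → Set
    StrictlyIncreasing w = lookup w Preserves Fin._<_ ⟶ Fin._<_

    increasing⇔ : ∀ {m} (w : Vec (Fin n) m) → increasing w ≡ true ⇔ StrictlyIncreasing w
    increasing⇔ {m} w = mk⇔
      (λ inc {a} {b} a<b → Equivalence.to (pair a b) (Equivalence.to (all-allFin _) (Equivalence.to (all-allFin _) inc a) b) a<b)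
      (λ mono → Equivalence.from (all-allFin _) (λ a → Equivalence.from (all-allFin _) (λ b →
                  Equivalence.from (pair a b) mono)))
      where
      pair : ∀ a b → (not (toℕ a <ᵇ toℕ b) ∨ (toℕ (lookup w a) <ᵇ toℕ (lookup w b))) ≡ true
                     ⇔ (a Fin.< b → lookup w a Fin.< lookup w b)
      pair a b with toℕ a <ᵇ toℕ b in a<ᵇb
      ... | false = mk⇔ (λ _ a<b → ⊥-elim (<⇒≱ a<b (s≤s⁻¹ (≤ᵇ≡false⇒> {suc (toℕ a)} a<ᵇb)))) (λ _ → refl)
      ... | true  = mk⇔ (λ wa<ᵇwb _ → ≤ᵇ≡true⇒≤ wa<ᵇwb) (λ mono → ≤⇒≤ᵇ≡true (mono (≤ᵇ≡true⇒≤ a<ᵇb)))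

    increasingFrom⁺ : ∀ {m} lo (w : Vec (Fin n) m) → StrictlyIncreasing w → (∀ i → lo ≤ toℕ (lookup w i)) →
                      increasingFrom lo w ≡ true
    increasingFrom⁺ lo []      _    _     = refl
    increasingFrom⁺ lo (x ∷ w) mono bound rewrite ≤⇒≤ᵇ≡true (bound zero) =
      increasingFrom⁺ (suc (toℕ x)) w (λ a<b → mono (s<s a<b)) (λ i → mono {zero} {suc i} z<s)

    increasingFrom⁻ : ∀ {m} lo (w : Vec (Fin n) m) → increasingFrom lo w ≡ true →
                      StrictlyIncreasing w × (∀ i → lo ≤ toℕ (lookup w i))
    increasingFrom⁻ lo []      _   = (λ { {()} }) , λ ()
    increasingFrom⁻ lo (x ∷ w) inc with lo ≤ᵇ toℕ x in lo≤ᵇx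
    ... | true with mono , above ← increasingFrom⁻ (suc (toℕ x)) w inc = mono∷ , bound
      where
      mono∷ : StrictlyIncreasing (x ∷ w)
      mono∷ {zero}  {suc b} _   = above b
      mono∷ {suc a} {suc b} a<b = mono (s<s⁻¹ a<b)
      bound : ∀ i → lo ≤ toℕ (lookup (x ∷ w) i)
      bound zero    = ≤ᵇ≡true⇒≤ lo≤ᵇx
      bound (suc i) = ≤-trans (≤ᵇ≡true⇒≤ lo≤ᵇx) (<⇒≤ (above i))

    increasing≡increasingFrom0 : ∀ {m} (w : Vec (Fin n) m) → increasing w ≡ increasingFrom 0 w
    increasing≡increasingFrom0 w = ⇔→≡ {z = true} (mk⇔
      (λ inc → increasingFrom⁺ 0 w (Equivalence.to (increasing⇔ w) inc) (λ _ → z≤n))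
      (λ inc → Equivalence.from (increasing⇔ w) (proj₁ (increasingFrom⁻ 0 w inc))))

    StrictlyIncreasing⇒distinct : ∀ {m} (w : Vec (Fin n) m) → StrictlyIncreasing w → distinct w ≡ true
    StrictlyIncreasing⇒distinct w mono = distinct⁺ w injective
      where
      injective : ∀ {a b} → lookup w a ≡ lookup w b → a ≡ b
      injective {a} {b} wa≡wb with <-cmp (toℕ a) (toℕ b)
      ... | tri< a<b _ _ = ⊥-elim (<-irrefl (cong toℕ wa≡wb) (mono a<b))
      ... | tri≈ _ a≡b _ = Fin.toℕ-injective a≡b
      ... | tri> _ _ b<a = ⊥-elim (<-irrefl (cong toℕ (sym wa≡wb)) (mono b<a))

    count-increasing : ∀ k → ∑ (allVecs n k) (λ w → [ increasing w ]· 1) ≡ n C k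
    count-increasing k = trans (∑-cong (allVecs n k) (λ w → cong ([_]· 1) (increasing≡increasingFrom0 w)))
                               (count-increasingFrom k 0)

    ∑-increasing-const : ∀ k a → ∑ (allVecs n k) (λ w → [ increasing w ]· a) ≡ (n C k) * a
    ∑-increasing-const k a = trans (∑-[]·-const (allVecs n k) increasing a) (cong (_* a) (count-increasing k))

    rankCount : ∀ {k} → Fin k → Fin n → ℕ
    rankCount {k} r y = (toℕ y C toℕ r) * ((n ∸ suc (toℕ y)) C (k ∸ suc (toℕ r)))

    count-increasing-at : ∀ k (r : Fin k) (y : Fin n) →
      ∑ (allVecs n k) (λ w → [ increasing w ]· [ lookup w r == y ]· 1) ≡ rankCount r y
    count-increasing-at k r y =
      trans (∑-cong (allVecs n k) (λ w → cong ([_]· [ lookup w r == y ]· 1) (increasing≡increasingFrom0 w)))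
            (count-increasingFrom-at k r 0 y)

    count-increasing-∉ : ∀ k (y : Fin n) → ∑ (allVecs n k) (λ w → [ increasing w ]· [ y ∉ᵇ w ]· 1) ≡ (n ∸ 1) C k
    count-increasing-∉ k y =
      trans (∑-cong (allVecs n k) (λ w → cong ([_]· [ y ∉ᵇ w ]· 1) (increasing≡increasingFrom0 w)))
            (count-increasingFrom-∉ k 0 y)

  -- Order patterns

  module _ {n k : ℕ} (σ : Permutation′ k) where

    hasPattern : Vec (Fin n) k → Bool
    hasPattern v = all (λ a → all (λ b →
      (toℕ (lookup v b) <ᵇ toℕ (lookup v a)) ⇔ᵇ (toℕ (σ ⟨$⟩ʳ b) <ᵇ toℕ (σ ⟨$⟩ʳ a))) (allFin k)) (allFin k)

    isPattern≡hasPattern : ∀ (π : Perm n) (idx : Vec (Fin n) k) → isPattern σ π idx ≡ hasPattern (rearrange (lookup idx) π)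
    isPattern≡hasPattern π idx = all-cong (allFin k) (λ a → all-cong (allFin k) (λ b →
      cong₂ (λ u v → (toℕ u <ᵇ toℕ v) ⇔ᵇ (toℕ (σ ⟨$⟩ʳ b) <ᵇ toℕ (σ ⟨$⟩ʳ a)))
            (sym (lookup-rearrange (lookup idx) π b)) (sym (lookup-rearrange (lookup idx) π a))))

    hasPattern⇔ : ∀ v → hasPattern v ≡ true ⇔
                  (∀ a b → (toℕ (lookup v b) <ᵇ toℕ (lookup v a)) ≡ (toℕ (σ ⟨$⟩ʳ b) <ᵇ toℕ (σ ⟨$⟩ʳ a)))
    hasPattern⇔ v = mk⇔
      (λ pat a b → Equivalence.to ⇔ᵇ≡true (Equivalence.to (all-allFin _) (Equivalence.to (all-allFin _) pat a) b))
      (λ same → Equivalence.from (all-allFin _) (λ a → Equivalence.from (all-allFin _) (λ b →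
                  Equivalence.from ⇔ᵇ≡true (same a b))))
      where
      ⇔ᵇ≡true : ∀ {x y} → (x ⇔ᵇ y) ≡ true ⇔ x ≡ y
      ⇔ᵇ≡true {true}  {true}  = mk⇔ (λ _ → refl) (λ _ → refl)
      ⇔ᵇ≡true {true}  {false} = mk⇔ (λ ()) (λ ())
      ⇔ᵇ≡true {false} {true}  = mk⇔ (λ ()) (λ ())
      ⇔ᵇ≡true {false} {false} = mk⇔ (λ _ → refl) (λ _ → refl)

    <ᵇ-irrefl : ∀ {m} (i : Fin m) → (toℕ i <ᵇ toℕ i) ≡ false
    <ᵇ-irrefl i = ≥⇒<ᵇ≡false (≤-refl {toℕ i})

    hasPattern⇒distinct : ∀ v → hasPattern v ≡ true → distinct v ≡ true
    hasPattern⇒distinct v pat = distinct⁺ v injective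
      where
      open ≡-Reasoning
      same = Equivalence.to (hasPattern⇔ v) pat
      false≢true : false ≢ true
      false≢true ()
      injective : ∀ {a b} → lookup v a ≡ lookup v b → a ≡ b
      injective {a} {b} va≡vb with <-cmp (toℕ (σ ⟨$⟩ʳ b)) (toℕ (σ ⟨$⟩ʳ a))
      ... | tri< σb<σa _ _ = ⊥-elim (false≢true (begin
        false                                      ≡⟨ <ᵇ-irrefl (lookup v a) ⟨
        toℕ (lookup v a) <ᵇ toℕ (lookup v a)       ≡⟨ cong (λ u → toℕ u <ᵇ toℕ (lookup v a)) va≡vb ⟩
        toℕ (lookup v b) <ᵇ toℕ (lookup v a)       ≡⟨ same a b ⟩
        toℕ (σ ⟨$⟩ʳ b) <ᵇ toℕ (σ ⟨$⟩ʳ a)           ≡⟨ ≤⇒≤ᵇ≡true σb<σa ⟩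
        true                                       ∎))
      ... | tri≈ _ σb≡σa _ = sym (⟨$⟩ʳ-injective σ (Fin.toℕ-injective σb≡σa))
      ... | tri> _ _ σa<σb = ⊥-elim (false≢true (begin
        false                                      ≡⟨ <ᵇ-irrefl (lookup v a) ⟨
        toℕ (lookup v a) <ᵇ toℕ (lookup v a)       ≡⟨ cong (λ u → toℕ (lookup v a) <ᵇ toℕ u) va≡vb ⟩
        toℕ (lookup v a) <ᵇ toℕ (lookup v b)       ≡⟨ same b a ⟩
        toℕ (σ ⟨$⟩ʳ a) <ᵇ toℕ (σ ⟨$⟩ʳ b)           ≡⟨ ≤⇒≤ᵇ≡true σa<σb ⟩
        true                                       ∎))

    hasPattern-permute : ∀ w → hasPattern (rearrange (σ ⟨$⟩ʳ_) w) ≡ increasing w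
    hasPattern-permute w = ⇔→≡ {z = true} (mk⇔
      (λ pat → Equivalence.from (increasing⇔ w) (λ {c} {d} c<d →
        ≤ᵇ≡true⇒≤ (begin
          toℕ (lookup w c) <ᵇ toℕ (lookup w d)
            ≡⟨ cong₂ (λ i j → toℕ (lookup w i) <ᵇ toℕ (lookup w j)) (inverseʳ σ) (inverseʳ σ) ⟨
          toℕ (lookup w (σ ⟨$⟩ʳ (σ ⟨$⟩ˡ c))) <ᵇ toℕ (lookup w (σ ⟨$⟩ʳ (σ ⟨$⟩ˡ d)))
            ≡⟨ cong₂ (λ u v → toℕ u <ᵇ toℕ v) (lookup-rearrange _ w (σ ⟨$⟩ˡ c)) (lookup-rearrange _ w (σ ⟨$⟩ˡ d)) ⟨
          toℕ (lookup v (σ ⟨$⟩ˡ c)) <ᵇ toℕ (lookup v (σ ⟨$⟩ˡ d))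
            ≡⟨ Equivalence.to (hasPattern⇔ v) pat (σ ⟨$⟩ˡ d) (σ ⟨$⟩ˡ c) ⟩
          toℕ (σ ⟨$⟩ʳ (σ ⟨$⟩ˡ c)) <ᵇ toℕ (σ ⟨$⟩ʳ (σ ⟨$⟩ˡ d))
            ≡⟨ cong₂ (λ i j → toℕ i <ᵇ toℕ j) (inverseʳ σ) (inverseʳ σ) ⟩
          toℕ c <ᵇ toℕ d
            ≡⟨ ≤⇒≤ᵇ≡true c<d ⟩
          true ∎)))
      (λ inc → Equivalence.from (hasPattern⇔ v) (λ a b →
        trans (cong₂ (λ u v → toℕ u <ᵇ toℕ v) (lookup-rearrange _ w b) (lookup-rearrange _ w a))
              (same-order (Equivalence.to (increasing⇔ w) inc) (σ ⟨$⟩ʳ b) (σ ⟨$⟩ʳ a)))))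
      where
      open ≡-Reasoning
      v = rearrange (σ ⟨$⟩ʳ_) w
      same-order : StrictlyIncreasing w → ∀ c d → (toℕ (lookup w c) <ᵇ toℕ (lookup w d)) ≡ (toℕ c <ᵇ toℕ d)
      same-order mono c d with <-cmp (toℕ c) (toℕ d)
      ... | tri< c<d _ _ = trans (≤⇒≤ᵇ≡true (mono c<d)) (sym (≤⇒≤ᵇ≡true c<d))
      ... | tri≈ _ c≡d _ rewrite Fin.toℕ-injective c≡d = trans (<ᵇ-irrefl (lookup w d)) (sym (<ᵇ-irrefl d))
      ... | tri> _ _ d<c = trans (≥⇒<ᵇ≡false (<⇒≤ (mono d<c))) (sym (≥⇒<ᵇ≡false (<⇒≤ d<c)))

    ∑-hasPattern : ∀ (h : Vec (Fin n) k → ℕ) →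
      ∑ (allVecs n k) (λ v → [ distinct v ]· [ hasPattern v ]· h v)
        ≡ ∑ (allVecs n k) (λ w → [ increasing w ]· h (rearrange (σ ⟨$⟩ʳ_) w))
    ∑-hasPattern h = begin
      ∑ (allVecs n k) (λ v → [ distinct v ]· [ hasPattern v ]· h v)  ≡⟨ ∑-cong (allVecs n k) drop-distinct ⟩
      ∑ (allVecs n k) F                                               ≡⟨ ∑-allVecs-reindex (permute σ) F ⟨
      ∑ (allVecs n k) (λ w → F (rearrange (σ ⟨$⟩ʳ_) w))              ≡⟨ ∑-cong (allVecs n k) (λ w →
                                                                           cong ([_]· h (rearrange (σ ⟨$⟩ʳ_) w)) (hasPattern-permute w)) ⟩
      ∑ (allVecs n k) (λ w → [ increasing w ]· h (rearrange (σ ⟨$⟩ʳ_) w)) ∎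
      where
      open ≡-Reasoning
      F : Vec (Fin n) k → ℕ
      F v = [ hasPattern v ]· h v
      drop-distinct : ∀ v → [ distinct v ]· [ hasPattern v ]· h v ≡ F v
      drop-distinct v with hasPattern v in pat
      ... | false = []·-0 (distinct v)
      ... | true rewrite hasPattern⇒distinct v pat = refl

    count-hasPattern : ∑ (allVecs n k) (λ v → [ distinct v ]· [ hasPattern v ]· 1) ≡ n C k
    count-hasPattern = trans (∑-hasPattern (λ _ → 1)) (count-increasing k)

    count-hasPattern-at : ∀ j (y : Fin n) →
      ∑ (allVecs n k) (λ v → [ distinct v ]· [ hasPattern v ]· [ lookup v j == y ]· 1) ≡ rankCount (σ ⟨$⟩ʳ j) y
    count-hasPattern-at j y = begin
      ∑ (allVecs n k) (λ v → [ distinct v ]· [ hasPattern v ]· [ lookup v j == y ]· 1)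
        ≡⟨ ∑-hasPattern (λ v → [ lookup v j == y ]· 1) ⟩
      ∑ (allVecs n k) (λ w → [ increasing w ]· [ lookup (rearrange (σ ⟨$⟩ʳ_) w) j == y ]· 1)
        ≡⟨ ∑-cong (allVecs n k) (λ w → cong (λ u → [ increasing w ]· [ u == y ]· 1) (lookup-rearrange _ w j)) ⟩
      ∑ (allVecs n k) (λ w → [ increasing w ]· [ lookup w (σ ⟨$⟩ʳ j) == y ]· 1)
        ≡⟨ count-increasing-at k (σ ⟨$⟩ʳ j) y ⟩
      rankCount (σ ⟨$⟩ʳ j) y ∎
      where open ≡-Reasoning

    count-hasPattern-∉ : ∀ (y : Fin n) →
      ∑ (allVecs n k) (λ v → [ distinct v ]· [ hasPattern v ]· [ y ∉ᵇ v ]· 1) ≡ (n ∸ 1) C k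
    count-hasPattern-∉ y = begin
      ∑ (allVecs n k) (λ v → [ distinct v ]· [ hasPattern v ]· [ y ∉ᵇ v ]· 1)
        ≡⟨ ∑-hasPattern (λ v → [ y ∉ᵇ v ]· 1) ⟩
      ∑ (allVecs n k) (λ w → [ increasing w ]· [ y ∉ᵇ rearrange (σ ⟨$⟩ʳ_) w ]· 1)
        ≡⟨ ∑-cong (allVecs n k) (λ w → cong (λ b → [ increasing w ]· [ b ]· 1) (∉ᵇ-permute σ y w)) ⟩
      ∑ (allVecs n k) (λ w → [ increasing w ]· [ y ∉ᵇ w ]· 1)
        ≡⟨ count-increasing-∉ k y ⟩
      (n ∸ 1) C k ∎
      where open ≡-Reasoning

  -- Sums over the symmetric group

  ∑-Sym : ∀ n (f : Perm n → ℕ) → ∑ (Sym n) f ≡ ∑ (allVecs n n) (λ π → [ distinct π ]· f π)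
  ∑-Sym n f = trans (∑-filter isInjective (allVecs n n) f)
                    (∑-cong (allVecs n n) (λ π → cong ([_]· f π) (isInjective≡distinct π)))

  ∑-Sym-restrict : ∀ {n m} (p : Vec (Fin n) m) → distinct p ≡ true → (g : Vec (Fin n) m → ℕ) →
    ∑ (Sym n) (λ π → g (rearrange (lookup p) π)) ≡ (n ∸ m) ! * ∑ (allVecs n m) (λ u → [ distinct u ]· g u)
  ∑-Sym-restrict {n} {m} p d g =
    trans (∑-Sym n (λ π → g (rearrange (lookup p) π)))
          (trans (∑-distinct-restrict p d g) (cong (_* ∑ (allVecs n m) (λ u → [ distinct u ]· g u)) (nP′n≡n! (n ∸ m))))

  module _ {n k : ℕ} (σ : Permutation′ k) where

    occursAt : Perm n → Vec (Fin n) k → Bool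
    occursAt π idx = hasPattern σ (rearrange (lookup idx) π)

    N≡∑-occursAt : ∀ π → N σ π ≡ ∑ (allVecs n k) (λ idx → [ increasing idx ]· [ occursAt π idx ]· 1)
    N≡∑-occursAt π = trans (length-filterᵇ _ (allVecs n k)) (∑-cong (allVecs n k) (λ idx →
      trans ([]·-∧ (increasing idx) (isPattern σ π idx) 1)
            (cong (λ b → [ increasing idx ]· [ b ]· 1) (isPattern≡hasPattern σ π idx))))

    ∑-Sym-*N : ∀ (F : Perm n → ℕ) → ∑ (Sym n) (λ π → F π * N σ π)
               ≡ ∑ (allVecs n k) (λ idx → [ increasing idx ]· ∑ (Sym n) (λ π → F π * [ occursAt π idx ]· 1))
    ∑-Sym-*N F = begin
      ∑ (Sym n) (λ π → F π * N σ π)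
        ≡⟨ ∑-cong (Sym n) (λ π → trans (cong (F π *_) (N≡∑-occursAt π))
             (trans (*-distribˡ-∑ (F π) (allVecs n k) _)
                    (∑-cong (allVecs n k) (λ idx → *-[]· (increasing idx) (F π) ([ occursAt π idx ]· 1))))) ⟩
      ∑ (Sym n) (λ π → ∑ (allVecs n k) (λ idx → [ increasing idx ]· (F π * [ occursAt π idx ]· 1)))
        ≡⟨ ∑-comm (Sym n) (allVecs n k) _ ⟩
      ∑ (allVecs n k) (λ idx → ∑ (Sym n) (λ π → [ increasing idx ]· (F π * [ occursAt π idx ]· 1)))
        ≡⟨ ∑-cong (allVecs n k) (λ idx → ∑-[]· (Sym n) (increasing idx) (λ π → F π * [ occursAt π idx ]· 1)) ⟩
      ∑ (allVecs n k) (λ idx → [ increasing idx ]· ∑ (Sym n) (λ π → F π * [ occursAt π idx ]· 1)) ∎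
      where open ≡-Reasoning

    module _ (idx : Vec (Fin n) k) (inc : increasing idx ≡ true) where

      distinct-idx : distinct idx ≡ true
      distinct-idx = StrictlyIncreasing⇒distinct idx (Equivalence.to (increasing⇔ idx) inc)

      count-occursAt : ∑ (Sym n) (λ π → [ occursAt π idx ]· 1) ≡ (n ∸ k) ! * (n C k)
      count-occursAt = trans (∑-Sym-restrict idx distinct-idx (λ u → [ hasPattern σ u ]· 1))
                             (cong ((n ∸ k) ! *_) (count-hasPattern σ))

      ∑-occursAt-fixing-position : ∀ j →
        ∑ (Sym n) (λ π → [ lookup π (lookup idx j) == lookup idx j ]· [ occursAt π idx ]· 1)
          ≡ (n ∸ k) ! * rankCount (σ ⟨$⟩ʳ j) (lookup idx j)
      ∑-occursAt-fixing-position j = begin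
        ∑ (Sym n) (λ π → [ lookup π (lookup idx j) == y ]· [ occursAt π idx ]· 1)
          ≡⟨ ∑-cong (Sym n) (λ π → cong (λ z → [ z == y ]· [ occursAt π idx ]· 1)
                                        (sym (lookup-rearrange (lookup idx) π j))) ⟩
        ∑ (Sym n) (λ π → g (rearrange (lookup idx) π))
          ≡⟨ ∑-Sym-restrict idx distinct-idx g ⟩
        (n ∸ k) ! * ∑ (allVecs n k) (λ u → [ distinct u ]· g u)
          ≡⟨ cong ((n ∸ k) ! *_) (∑-cong (allVecs n k) (λ u →
               cong ([ distinct u ]·_) ([]·-comm (lookup u j == y) (hasPattern σ u) 1))) ⟩
        (n ∸ k) ! * ∑ (allVecs n k) (λ u → [ distinct u ]· [ hasPattern σ u ]· [ lookup u j == y ]· 1)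
          ≡⟨ cong ((n ∸ k) ! *_) (count-hasPattern-at σ j y) ⟩
        (n ∸ k) ! * rankCount (σ ⟨$⟩ʳ j) y ∎
        where
        open ≡-Reasoning
        y = lookup idx j
        g : Vec (Fin n) k → ℕ
        g u = [ lookup u j == y ]· [ hasPattern σ u ]· 1

      ∑-occursAt-fixing-point : ∀ x → (x ∉ᵇ idx) ≡ true →
        ∑ (Sym n) (λ π → [ lookup π x == x ]· [ occursAt π idx ]· 1) ≡ (n ∸ suc k) ! * ((n ∸ 1) C k)
      -- The first step is definitional: rearranging π along x ∷ idx reads π at x first.
      ∑-occursAt-fixing-point x x∉idx = begin
        ∑ (Sym n) (λ π → g (rearrange (lookup (x ∷ idx)) π))
          ≡⟨ ∑-Sym-restrict (x ∷ idx) (cong₂ _∧_ x∉idx distinct-idx) g ⟩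
        (n ∸ suc k) ! * ∑ (allVecs n (suc k)) (λ v → [ distinct v ]· g v)
          ≡⟨ cong ((n ∸ suc k) ! *_) (∑-allVecs-suc n k _) ⟩
        (n ∸ suc k) ! * ∑ (allFin n) (λ y → ∑ (allVecs n k) (λ u → [ (y ∉ᵇ u) ∧ distinct u ]· [ y == x ]· [ hasPattern σ u ]· 1))
          ≡⟨ cong ((n ∸ suc k) ! *_) (∑-cong (allFin n) (λ y →
               trans (∑-cong (allVecs n k) (λ u → []·-comm ((y ∉ᵇ u) ∧ distinct u) (y == x) _))
                     (∑-[]· (allVecs n k) (y == x) _))) ⟩
        (n ∸ suc k) ! * ∑ (allFin n) (λ y → [ y == x ]· ∑ (allVecs n k) (λ u → [ (y ∉ᵇ u) ∧ distinct u ]· [ hasPattern σ u ]· 1))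
          ≡⟨ cong ((n ∸ suc k) ! *_) (∑-allFin-δ x _) ⟩
        (n ∸ suc k) ! * ∑ (allVecs n k) (λ u → [ (x ∉ᵇ u) ∧ distinct u ]· [ hasPattern σ u ]· 1)
          ≡⟨ cong ((n ∸ suc k) ! *_) (∑-cong (allVecs n k) (λ u → reorder (x ∉ᵇ u) (distinct u) (hasPattern σ u))) ⟩
        (n ∸ suc k) ! * ∑ (allVecs n k) (λ u → [ distinct u ]· [ hasPattern σ u ]· [ x ∉ᵇ u ]· 1)
          ≡⟨ cong ((n ∸ suc k) ! *_) (count-hasPattern-∉ σ x) ⟩
        (n ∸ suc k) ! * ((n ∸ 1) C k) ∎
        where
        open ≡-Reasoning
        g : Vec (Fin n) (suc k) → ℕ
        g (y ∷ u) = [ y == x ]· [ hasPattern σ u ]· 1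
        reorder : ∀ a b c → [ a ∧ b ]· [ c ]· 1 ≡ [ b ]· [ c ]· [ a ]· 1
        reorder a b c = trans ([]·-∧ a b _) (trans ([]·-comm a b _) (cong ([ b ]·_) ([]·-comm a c 1)))

      fixedPoints*occursAt : ∀ π → fixedPoints π * [ occursAt π idx ]· 1
        ≡ ∑ (allFin k) (λ j → [ lookup π (lookup idx j) == lookup idx j ]· [ occursAt π idx ]· 1)
          + ∑ (allFin n) (λ x → [ x ∉ᵇ idx ]· [ lookup π x == x ]· [ occursAt π idx ]· 1)
      fixedPoints*occursAt π = begin
        fixedPoints π * o                               ≡⟨ cong (_* o) (length-filterᵇ _ (allFin n)) ⟩
        ∑ (allFin n) (λ x → [ lookup π x == x ]· 1) * o  ≡⟨ cong (_* o) (∑-split-∉ᵇ idx distinct-idx (λ x → [ lookup π x == x ]· 1)) ⟩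
        (inside + outside) * o                          ≡⟨ *-distribʳ-+ o inside outside ⟩
        inside * o + outside * o
          ≡⟨ cong₂ _+_ (trans (*-distribʳ-∑ o (allFin k) _)
                              (∑-cong (allFin k) (λ j → []·1-* (lookup π (lookup idx j) == lookup idx j) o)))
                       (trans (*-distribʳ-∑ o (allFin n) _)
                              (∑-cong (allFin n) (λ x → []·[]·1-* (x ∉ᵇ idx) (lookup π x == x) o))) ⟩
        ∑ (allFin k) (λ j → [ lookup π (lookup idx j) == lookup idx j ]· o)
          + ∑ (allFin n) (λ x → [ x ∉ᵇ idx ]· [ lookup π x == x ]· o) ∎
        where
        open ≡-Reasoning
        o = [ occursAt π idx ]· 1
        inside = ∑ (allFin k) (λ j → [ lookup π (lookup idx j) == lookup idx j ]· 1)
        outside = ∑ (allFin n) (λ x → [ x ∉ᵇ idx ]· [ lookup π x == x ]· 1)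

      ∑-fixing-points : k < n →
        ∑ (allFin n) (λ x → [ x ∉ᵇ idx ]· ∑ (Sym n) (λ π → [ lookup π x == x ]· [ occursAt π idx ]· 1))
          ≡ (n ∸ k) ! * ((n ∸ 1) C k)
      ∑-fixing-points k<n = begin
        ∑ (allFin n) (λ x → [ x ∉ᵇ idx ]· ∑ (Sym n) (λ π → [ lookup π x == x ]· [ occursAt π idx ]· 1))
          ≡⟨ ∑-[]·-cong (allFin n) (_∉ᵇ idx) ∑-occursAt-fixing-point ⟩
        ∑ (allFin n) (λ x → [ x ∉ᵇ idx ]· c)
          ≡⟨ ∑-[]·-const (allFin n) (_∉ᵇ idx) c ⟩
        ∑ (allFin n) (λ x → [ x ∉ᵇ idx ]· 1) * c
          ≡⟨ cong (_* c) (count-∉ᵇ idx distinct-idx) ⟩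
        (n ∸ k) * ((n ∸ suc k) ! * ((n ∸ 1) C k))
          ≡⟨ *-assoc (n ∸ k) _ _ ⟨
        (n ∸ k) * (n ∸ suc k) ! * ((n ∸ 1) C k)
          ≡⟨ cong (_* ((n ∸ 1) C k)) ([n-k]*[n-k-1]!≡[n-k]! k<n) ⟩
        (n ∸ k) ! * ((n ∸ 1) C k) ∎
        where
        open ≡-Reasoning
        c = (n ∸ suc k) ! * ((n ∸ 1) C k)

      ∑-fixedPoints-occursAt : k < n →
        ∑ (Sym n) (λ π → fixedPoints π * [ occursAt π idx ]· 1)
          ≡ (n ∸ k) ! * (∑ (allFin k) (λ j → rankCount (σ ⟨$⟩ʳ j) (lookup idx j)) + (n ∸ 1) C k)
      ∑-fixedPoints-occursAt k<n = begin
        ∑ (Sym n) (λ π → fixedPoints π * [ occursAt π idx ]· 1)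
          ≡⟨ trans (∑-cong (Sym n) fixedPoints*occursAt) (∑-distrib-+ (Sym n) _ _) ⟩
        ∑ (Sym n) (λ π → ∑ (allFin k) (λ j → [ lookup π (lookup idx j) == lookup idx j ]· [ occursAt π idx ]· 1))
          + ∑ (Sym n) (λ π → ∑ (allFin n) (λ x → [ x ∉ᵇ idx ]· [ lookup π x == x ]· [ occursAt π idx ]· 1))
          ≡⟨ cong₂ _+_ (∑-comm (Sym n) (allFin k) _)
                       (trans (∑-comm (Sym n) (allFin n) _) (∑-cong (allFin n) (λ x → ∑-[]· (Sym n) (x ∉ᵇ idx) _))) ⟩
        ∑ (allFin k) (λ j → ∑ (Sym n) (λ π → [ lookup π (lookup idx j) == lookup idx j ]· [ occursAt π idx ]· 1))
          + ∑ (allFin n) (λ x → [ x ∉ᵇ idx ]· ∑ (Sym n) (λ π → [ lookup π x == x ]· [ occursAt π idx ]· 1))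
          ≡⟨ cong₂ _+_ (∑-cong (allFin k) ∑-occursAt-fixing-position) (∑-fixing-points k<n) ⟩
        ∑ (allFin k) (λ j → (n ∸ k) ! * rankCount (σ ⟨$⟩ʳ j) (lookup idx j)) + (n ∸ k) ! * ((n ∸ 1) C k)
          ≡⟨ cong (_+ (n ∸ k) ! * ((n ∸ 1) C k)) (*-distribˡ-∑ ((n ∸ k) !) (allFin k) _) ⟨
        (n ∸ k) ! * R + (n ∸ k) ! * ((n ∸ 1) C k)
          ≡⟨ *-distribˡ-+ ((n ∸ k) !) R ((n ∸ 1) C k) ⟨
        (n ∸ k) ! * (R + (n ∸ 1) C k) ∎
        where
        open ≡-Reasoning
        R = ∑ (allFin k) (λ j → rankCount (σ ⟨$⟩ʳ j) (lookup idx j))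

    ∑-N : ∑ (Sym n) (N σ) ≡ (n ∸ k) ! * ((n C k) * (n C k))
    ∑-N = begin
      ∑ (Sym n) (N σ)
        ≡⟨ ∑-cong (Sym n) (λ π → sym (*-identityˡ (N σ π))) ⟩
      ∑ (Sym n) (λ π → 1 * N σ π)
        ≡⟨ ∑-Sym-*N (λ _ → 1) ⟩
      ∑ (allVecs n k) (λ idx → [ increasing idx ]· ∑ (Sym n) (λ π → 1 * [ occursAt π idx ]· 1))
        ≡⟨ ∑-[]·-cong (allVecs n k) increasing (λ idx inc →
             trans (∑-cong (Sym n) (λ π → *-identityˡ _)) (count-occursAt idx inc)) ⟩
      ∑ (allVecs n k) (λ idx → [ increasing idx ]· ((n ∸ k) ! * (n C k)))
        ≡⟨ ∑-increasing-const k ((n ∸ k) ! * (n C k)) ⟩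
      (n C k) * ((n ∸ k) ! * (n C k))
        ≡⟨ x∙yz≈y∙xz (n C k) ((n ∸ k) !) (n C k) ⟩
      (n ∸ k) ! * ((n C k) * (n C k)) ∎
      where open ≡-Reasoning

    doubleSum≡∑-rankCount : doubleSum σ n
                 ≡ ∑ (allVecs n k) (λ idx → [ increasing idx ]· ∑ (allFin k) (λ j → rankCount (σ ⟨$⟩ʳ j) (lookup idx j)))
    doubleSum≡∑-rankCount = begin
      ∑ (allFin n) (λ y → ∑ (allFin k) (λ j → term y j))
        ≡⟨ ∑-cong (allFin n) (λ y → ∑-cong (allFin k) (λ j → regroup y j)) ⟩
      ∑ (allFin n) (λ y → ∑ (allFin k) (λ j → rankCount j y * rankCount (σ ⟨$⟩ʳ j) y))
        ≡⟨ ∑-comm (allFin n) (allFin k) _ ⟩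
      ∑ (allFin k) (λ j → ∑ (allFin n) (λ y → rankCount j y * rankCount (σ ⟨$⟩ʳ j) y))
        ≡⟨ ∑-cong (allFin k) (λ j → ∑-cong (allFin n) (λ y → cong (_* rankCount (σ ⟨$⟩ʳ j) y) (sym (count-increasing-at k j y)))) ⟩
      ∑ (allFin k) (λ j → ∑ (allFin n) (λ y → ∑ (allVecs n k) (λ idx → [ increasing idx ]· [ lookup idx j == y ]· 1) * rankCount (σ ⟨$⟩ʳ j) y))
        ≡⟨ ∑-cong (allFin k) (λ j → ∑-cong (allFin n) (λ y → trans (*-distribʳ-∑ (rankCount (σ ⟨$⟩ʳ j) y) (allVecs n k) _)
             (∑-cong (allVecs n k) (λ idx → []·[]·1-* (increasing idx) (lookup idx j == y) (rankCount (σ ⟨$⟩ʳ j) y))))) ⟩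
      ∑ (allFin k) (λ j → ∑ (allFin n) (λ y → ∑ (allVecs n k) (λ idx → [ increasing idx ]· [ lookup idx j == y ]· rankCount (σ ⟨$⟩ʳ j) y)))
        ≡⟨ ∑-cong (allFin k) (λ j → ∑-comm (allFin n) (allVecs n k) _) ⟩
      ∑ (allFin k) (λ j → ∑ (allVecs n k) (λ idx → ∑ (allFin n) (λ y → [ increasing idx ]· [ lookup idx j == y ]· rankCount (σ ⟨$⟩ʳ j) y)))
        ≡⟨ ∑-cong (allFin k) (λ j → ∑-cong (allVecs n k) (λ idx → trans (∑-[]· (allFin n) (increasing idx) _)
             (cong ([ increasing idx ]·_) (trans (∑-cong (allFin n) (λ y → cong ([_]· rankCount (σ ⟨$⟩ʳ j) y) (==-sym (lookup idx j) y)))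
                                                 (∑-allFin-δ (lookup idx j) (rankCount (σ ⟨$⟩ʳ j))))))) ⟩
      ∑ (allFin k) (λ j → ∑ (allVecs n k) (λ idx → [ increasing idx ]· rankCount (σ ⟨$⟩ʳ j) (lookup idx j)))
        ≡⟨ ∑-comm (allFin k) (allVecs n k) _ ⟩
      ∑ (allVecs n k) (λ idx → ∑ (allFin k) (λ j → [ increasing idx ]· rankCount (σ ⟨$⟩ʳ j) (lookup idx j)))
        ≡⟨ ∑-cong (allVecs n k) (λ idx → ∑-[]· (allFin k) (increasing idx) _) ⟩
      ∑ (allVecs n k) (λ idx → [ increasing idx ]· ∑ (allFin k) (λ j → rankCount (σ ⟨$⟩ʳ j) (lookup idx j))) ∎
      where
      open ≡-Reasoning
      term : Fin n → Fin k → ℕ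
      term y j = (toℕ y C toℕ j) * (toℕ y C toℕ (σ ⟨$⟩ʳ j))
                 * ((n ∸ suc (toℕ y)) C (k ∸ suc (toℕ j))) * ((n ∸ suc (toℕ y)) C (k ∸ suc (toℕ (σ ⟨$⟩ʳ j))))
      regroup : ∀ y j → term y j ≡ rankCount j y * rankCount (σ ⟨$⟩ʳ j) y
      regroup y j = trans (*-assoc (a * b) c d) (sym (*-interchange a c b d))
        where
        a = toℕ y C toℕ j
        b = toℕ y C toℕ (σ ⟨$⟩ʳ j)
        c = (n ∸ suc (toℕ y)) C (k ∸ suc (toℕ j))
        d = (n ∸ suc (toℕ y)) C (k ∸ suc (toℕ (σ ⟨$⟩ʳ j)))

    ∑-fixedPoints*N : k < n → ∑ (Sym n) (λ π → fixedPoints π * N σ π) ≡ (n ∸ k) ! * (doubleSum σ n + (n C k) * ((n ∸ 1) C k))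
    ∑-fixedPoints*N k<n = begin
      ∑ (Sym n) (λ π → fixedPoints π * N σ π)
        ≡⟨ ∑-Sym-*N fixedPoints ⟩
      ∑ (allVecs n k) (λ idx → [ increasing idx ]· ∑ (Sym n) (λ π → fixedPoints π * [ occursAt π idx ]· 1))
        ≡⟨ ∑-[]·-cong (allVecs n k) increasing (λ idx inc → ∑-fixedPoints-occursAt idx inc k<n) ⟩
      ∑ (allVecs n k) (λ idx → [ increasing idx ]· ((n ∸ k) ! * (R idx + c₁)))
        ≡⟨ ∑-cong (allVecs n k) (λ idx → sym (*-[]· (increasing idx) ((n ∸ k) !) (R idx + c₁))) ⟩
      ∑ (allVecs n k) (λ idx → (n ∸ k) ! * [ increasing idx ]· (R idx + c₁))
        ≡⟨ *-distribˡ-∑ ((n ∸ k) !) (allVecs n k) _ ⟨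
      (n ∸ k) ! * ∑ (allVecs n k) (λ idx → [ increasing idx ]· (R idx + c₁))
        ≡⟨ cong ((n ∸ k) ! *_) (trans (∑-cong (allVecs n k) (λ idx → []·-+ (increasing idx) (R idx) c₁))
                                      (∑-distrib-+ (allVecs n k) _ _)) ⟩
      (n ∸ k) ! * (∑ (allVecs n k) (λ idx → [ increasing idx ]· R idx) + ∑ (allVecs n k) (λ idx → [ increasing idx ]· c₁))
        ≡⟨ cong (λ s → (n ∸ k) ! * (s + ∑ (allVecs n k) (λ idx → [ increasing idx ]· c₁))) (sym doubleSum≡∑-rankCount) ⟩
      (n ∸ k) ! * (doubleSum σ n + ∑ (allVecs n k) (λ idx → [ increasing idx ]· c₁))
        ≡⟨ cong (λ s → (n ∸ k) ! * (doubleSum σ n + s)) (∑-increasing-const k c₁) ⟩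
      (n ∸ k) ! * (doubleSum σ n + (n C k) * c₁) ∎
      where
      open ≡-Reasoning
      R : Vec (Fin n) k → ℕ
      R idx = ∑ (allFin k) (λ j → rankCount (σ ⟨$⟩ʳ j) (lookup idx j))
      c₁ = (n ∸ 1) C k

  -- Conjugacy

  ∈-filterᵇ⁺ : ∀ {B : Set} (p : B → Bool) {x} (xs : List B) → x ∈ xs → p x ≡ true → x ∈ filterᵇ p xs
  ∈-filterᵇ⁺ p (y ∷ xs) (here refl) px rewrite px = here refl
  ∈-filterᵇ⁺ p (y ∷ xs) (there x∈xs) px with p y
  ... | true  = there (∈-filterᵇ⁺ p xs x∈xs px)
  ... | false = ∈-filterᵇ⁺ p xs x∈xs px

  ∈-filterᵇ⁻ : ∀ {B : Set} (p : B → Bool) {x} (xs : List B) → x ∈ filterᵇ p xs → x ∈ xs × p x ≡ true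
  ∈-filterᵇ⁻ p (y ∷ xs) x∈ with p y in py
  ∈-filterᵇ⁻ p (y ∷ xs) (here refl)  | true  = here refl , py
  ∈-filterᵇ⁻ p (y ∷ xs) (there x∈)   | true  = let x∈xs , px = ∈-filterᵇ⁻ p xs x∈ in there x∈xs , px
  ∈-filterᵇ⁻ p (y ∷ xs) x∈           | false = let x∈xs , px = ∈-filterᵇ⁻ p xs x∈ in there x∈xs , px

  ∈-allVecs : ∀ {n m} (v : Vec (Fin n) m) → v ∈ allVecs n m
  ∈-allVecs []      = here refl
  ∈-allVecs {n} {suc m} (x ∷ v) =
    ∈-concatMap⁺ (λ y → map (y ∷_) (allVecs n m)) (Any.map (λ { refl → ∈-map⁺ (x ∷_) (∈-allVecs v) }) (∈-allFin x))

  module _ {n : ℕ} where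

    ∈-Sym⁺ : ∀ {π : Perm n} → distinct π ≡ true → π ∈ Sym n
    ∈-Sym⁺ {π} d = ∈-filterᵇ⁺ _ (allVecs n n) (∈-allVecs π) (trans (isInjective≡distinct π) d)

    ∈-Sym⁻ : ∀ {π : Perm n} → π ∈ Sym n → distinct π ≡ true
    ∈-Sym⁻ {π} π∈ = trans (sym (isInjective≡distinct π)) (proj₂ (∈-filterᵇ⁻ _ (allVecs n n) π∈))

  injective⇒surjective : ∀ {n} {f : Fin n → Fin n} → Injective _≡_ _≡_ f → ∀ y → ∃[ x ] f x ≡ y
  injective⇒surjective {suc n} {f} f-inj y with Fin.any? (λ x → f x Fin.≟ y)
  ... | yes hit = hit
  ... | no  miss = ⊥-elim (<-irrefl refl (Fin.injective⇒≤ {f = f′} f′-inj))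
    where
    misses : ∀ x → y ≢ f x
    misses x y≡fx = miss (x , sym y≡fx)
    f′ : Fin (suc n) → Fin n
    f′ x = punchOut (misses x)
    f′-inj : Injective _≡_ _≡_ f′
    f′-inj {a} {b} = f-inj ∘ Fin.punchOut-injective (misses a) (misses b)

  module _ {n : ℕ} where

    inverse : (g : Perm n) → distinct g ≡ true → Perm n
    inverse g d = tabulate (λ y → proj₁ (injective⇒surjective (distinct⁻ g d) y))

    module _ (g : Perm n) (d : distinct g ≡ true) where

      lookup-inverseʳ : ∀ y → lookup g (lookup (inverse g d) y) ≡ y
      lookup-inverseʳ y = trans (cong (lookup g) (lookup∘tabulate _ y)) (proj₂ (injective⇒surjective (distinct⁻ g d) y))

      lookup-inverseˡ : ∀ x → lookup (inverse g d) (lookup g x) ≡ x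
      lookup-inverseˡ x = distinct⁻ g d (lookup-inverseʳ (lookup g x))

      distinct-inverse : distinct (inverse g d) ≡ true
      distinct-inverse = distinct⁺ (inverse g d) (λ {y} {z} eq →
        trans (sym (lookup-inverseʳ y)) (trans (cong (lookup g) eq) (lookup-inverseʳ z)))

      toPermutation : Permutation′ n
      toPermutation = mk↔ₛ′ (lookup g) (lookup (inverse g d)) lookup-inverseʳ lookup-inverseˡ

    Conjugates : Perm n → Perm n → Perm n → Set
    Conjugates g π τ = ∀ x → lookup g (lookup π x) ≡ lookup τ (lookup g x)

    conjugate⇔ : ∀ π τ → conjugate π τ ≡ true ⇔ (∃[ g ] g ∈ Sym n × Conjugates g π τ)
    conjugate⇔ π τ = mk⇔
      (λ conj → let g , g∈ , conj-g = find (any⁻ p (Sym n) (Equivalence.from T-≡ conj))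
                in g , g∈ , λ x → Equivalence.to ==⇔≡ (Equivalence.to (all-allFin _) (Equivalence.to T-≡ conj-g) x))
      (λ (g , g∈ , conj-g) → Equivalence.to T-≡ (any⁺ p (lose g∈ (Equivalence.from T-≡
         (Equivalence.from (all-allFin _) (λ x → Equivalence.from ==⇔≡ (conj-g x)))))))
      where
      p : Perm n → Bool
      p g = all (λ x → lookup g (lookup π x) == lookup τ (lookup g x)) (allFin n)

    conjugate-refl : ∀ π → conjugate π π ≡ true
    conjugate-refl π = Equivalence.from (conjugate⇔ π π)
      ( Vec.allFin n
      , ∈-Sym⁺ (distinct⁺ (Vec.allFin n) (λ {i} {j} eq → trans (sym (lookup-allFin i)) (trans eq (lookup-allFin j))))
      , λ x → trans (lookup-allFin (lookup π x)) (cong (lookup π) (sym (lookup-allFin x))))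

    conjugate-sym : ∀ {π τ} → conjugate π τ ≡ true → conjugate τ π ≡ true
    conjugate-sym {π} {τ} conj with g , g∈ , conj-g ← Equivalence.to (conjugate⇔ π τ) conj =
      Equivalence.from (conjugate⇔ τ π) (g⁻¹ , ∈-Sym⁺ (distinct-inverse g d) , conj-g⁻¹)
      where
      d = ∈-Sym⁻ g∈
      g⁻¹ = inverse g d
      conj-g⁻¹ : Conjugates g⁻¹ τ π
      conj-g⁻¹ y = begin
        lookup g⁻¹ (lookup τ y)                          ≡⟨ cong (λ z → lookup g⁻¹ (lookup τ z)) (lookup-inverseʳ g d y) ⟨
        lookup g⁻¹ (lookup τ (lookup g (lookup g⁻¹ y)))  ≡⟨ cong (lookup g⁻¹) (conj-g (lookup g⁻¹ y)) ⟨
        lookup g⁻¹ (lookup g (lookup π (lookup g⁻¹ y)))  ≡⟨ lookup-inverseˡ g d _ ⟩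
        lookup π (lookup g⁻¹ y)                          ∎
        where open ≡-Reasoning

    conjugate-trans : ∀ {π τ ρ} → conjugate π τ ≡ true → conjugate τ ρ ≡ true → conjugate π ρ ≡ true
    conjugate-trans {π} {τ} {ρ} conj₁ conj₂
      with g , g∈ , conj-g ← Equivalence.to (conjugate⇔ π τ) conj₁
         | h , h∈ , conj-h ← Equivalence.to (conjugate⇔ τ ρ) conj₂ =
      Equivalence.from (conjugate⇔ π ρ)
        (h∘g , ∈-Sym⁺ (distinct-rearrange h (distinct⁻ g (∈-Sym⁻ g∈)) (∈-Sym⁻ h∈)) , conj-h∘g)
      where
      h∘g = rearrange (lookup g) h
      conj-h∘g : Conjugates h∘g π ρ
      conj-h∘g x = begin
        lookup h∘g (lookup π x)            ≡⟨ lookup-rearrange (lookup g) h (lookup π x) ⟩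
        lookup h (lookup g (lookup π x))   ≡⟨ cong (lookup h) (conj-g x) ⟩
        lookup h (lookup τ (lookup g x))   ≡⟨ conj-h (lookup g x) ⟩
        lookup ρ (lookup h (lookup g x))   ≡⟨ cong (lookup ρ) (lookup-rearrange (lookup g) h x) ⟨
        lookup ρ (lookup h∘g x)            ∎
        where open ≡-Reasoning

    conjugate-comm : ∀ π τ → conjugate π τ ≡ conjugate τ π
    conjugate-comm π τ = ⇔→≡ {z = true} (mk⇔ (conjugate-sym {π} {τ}) (conjugate-sym {τ} {π}))

    fixedPoints-conjugate : ∀ {π τ} → conjugate π τ ≡ true → fixedPoints π ≡ fixedPoints τ
    fixedPoints-conjugate {π} {τ} conj with g , g∈ , conj-g ← Equivalence.to (conjugate⇔ π τ) conj = begin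
      fixedPoints π                                           ≡⟨ length-filterᵇ _ (allFin n) ⟩
      ∑ (allFin n) (λ x → [ lookup π x == x ]· 1)             ≡⟨ ∑-cong (allFin n) (λ x → cong ([_]· 1) (moved x)) ⟩
      ∑ (allFin n) (λ x → [ lookup τ (lookup g x) == lookup g x ]· 1)
        ≡⟨ ∑-allFin-reindex (toPermutation g d) (λ y → [ lookup τ y == y ]· 1) ⟩
      ∑ (allFin n) (λ y → [ lookup τ y == y ]· 1)             ≡⟨ length-filterᵇ _ (allFin n) ⟨
      fixedPoints τ                                           ∎
      where
      open ≡-Reasoning
      d = ∈-Sym⁻ g∈
      moved : ∀ x → (lookup π x == x) ≡ (lookup τ (lookup g x) == lookup g x)
      moved x = does-≡ (lookup π x Fin.≟ x)
        (map′ (λ τgx≡gx → distinct⁻ g d (trans (conj-g x) τgx≡gx))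
              (λ πx≡x → trans (sym (conj-g x)) (cong (lookup g) πx≡x))
              (lookup τ (lookup g x) Fin.≟ lookup g x))

    length-conjClass : ∀ {π τ} → conjugate π τ ≡ true → length (conjClass π) ≡ length (conjClass τ)
    length-conjClass {π} {τ} conj = begin
      length (conjClass π)                        ≡⟨ length-filterᵇ _ (Sym n) ⟩
      ∑ (Sym n) (λ ρ → [ conjugate π ρ ]· 1)      ≡⟨ ∑-cong (Sym n) (λ ρ → cong ([_]· 1) (⇔→≡ {z = true} (mk⇔
                                                       (conjugate-trans {τ} {π} {ρ} (conjugate-sym {π} {τ} conj))
                                                       (conjugate-trans {π} {τ} {ρ} conj)))) ⟩
      ∑ (Sym n) (λ ρ → [ conjugate τ ρ ]· 1)      ≡⟨ length-filterᵇ _ (Sym n) ⟨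
      length (conjClass τ)                        ∎
      where open ≡-Reasoning

    length-conjClass≢0 : ∀ {π} → π ∈ Sym n → length (conjClass π) ≢ 0
    length-conjClass≢0 {π} π∈ with conjClass π | ∈-filterᵇ⁺ (conjugate π) (Sym n) π∈ (conjugate-refl π)
    ... | _ ∷ _ | _ = λ ()

module Rational where

  open import Algebra.Bundles using (CommutativeRing)
  open import Data.Bool using (true; false)
  open import Data.Empty using (⊥-elim)
  open import Data.Fin.Permutation using (Permutation′)
  open import Data.Integer as ℤ using (+_)
  import Data.Integer.Properties as ℤ
  open import Data.List using (List; []; _∷_; length)
  open import Data.List.Membership.Propositional using (_∈_)
  open import Data.Nat as ℕ using (ℕ; zero; suc; _∸_; _!; _≤_)
  import Data.Nat.Coprimality as Coprime
  open import Data.Nat.Combinatorics using (_C_; _P_; k![n∸k]!∣n!)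
  open import Data.Nat.Combinatorics.Specification using (nPk≡n!/[n∸k]!; nCk≡n!/k![n-k]!; [n∸k]!k!∣n!)
  open import Data.Nat.DivMod using (m/n*n≡m)
  open import Data.Nat.Divisibility using (∣-trans; m∣m*n)
  import Data.Nat.Properties as ℕ
  open import Data.Nat.Solver using () renaming (module +-*-Solver to ℕ-Solver)
  open import Data.Rational as ℚ using (ℚ; mkℚ; 1ℚ; _+_; _*_; _-_; -_)
  import Data.Rational.Properties as ℚ
  open import Data.Rational.Solver using (module +-*-Solver)
  open import Data.Rational.Unnormalised using (*≡*)
  import Data.Rational.Unnormalised.Properties as ℚᵘ
  open import Function using (_∘_)
  open import Relation.Binary.PropositionalEquality
  open import Defs using (ℕ→ℚ; _÷ℕ_; Perm; Sym; N; fixedPoints; conjugate; conjClass; χstd; a1)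
  open Counting using (conjugate-comm; fixedPoints-conjugate; length-conjClass; length-conjClass≢0)

  open ListSum (CommutativeRing.commutativeSemiring ℚ.+-*-commutativeRing) public

  open import Algebra.Properties.CommutativeSemigroup (CommutativeRing.*-commutativeSemigroup ℚ.+-*-commutativeRing)
    using (x∙yz≈y∙xz)

  fromℕ : ℕ → ℚ
  fromℕ m = mkℚ (+ m) 0 (Coprime.sym (Coprime.1-coprimeTo m))

  ℕ→ℚ≡fromℕ : ∀ m → ℕ→ℚ m ≡ fromℕ m
  ℕ→ℚ≡fromℕ m = ℚ.normalize-coprime (Coprime.sym (Coprime.1-coprimeTo m))

  ℕ→ℚ-+ : ∀ a b → ℕ→ℚ (a ℕ.+ b) ≡ ℕ→ℚ a + ℕ→ℚ b
  ℕ→ℚ-+ a b rewrite ℕ→ℚ≡fromℕ a | ℕ→ℚ≡fromℕ b | ℕ→ℚ≡fromℕ (a ℕ.+ b) =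
    ℚ.toℚᵘ-injective (ℚᵘ.≃-sym (ℚᵘ.≃-trans (ℚ.toℚᵘ-homo-+ (fromℕ a) (fromℕ b)) (*≡* numerators)))
    where
    numerators : ((+ a ℤ.* + 1) ℤ.+ (+ b ℤ.* + 1)) ℤ.* + 1 ≡ + (a ℕ.+ b) ℤ.* + 1
    numerators rewrite ℤ.*-identityʳ (+ a) | ℤ.*-identityʳ (+ b) = refl

  ℕ→ℚ-* : ∀ a b → ℕ→ℚ (a ℕ.* b) ≡ ℕ→ℚ a * ℕ→ℚ b
  ℕ→ℚ-* a b rewrite ℕ→ℚ≡fromℕ a | ℕ→ℚ≡fromℕ b | ℕ→ℚ≡fromℕ (a ℕ.* b) =
    ℚ.toℚᵘ-injective (ℚᵘ.≃-sym (ℚᵘ.≃-trans (ℚ.toℚᵘ-homo-* (fromℕ a) (fromℕ b)) (*≡* numerators)))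
    where
    numerators : (+ a ℤ.* + b) ℤ.* + 1 ≡ + (a ℕ.* b) ℤ.* + 1
    numerators = cong (ℤ._* + 1) (sym (ℤ.pos-* a b))

  ℕ→ℚ-∑ : ∀ {B : Set} (xs : List B) (f : B → ℕ) → ℕ→ℚ (Counting.∑ xs f) ≡ ∑ xs (ℕ→ℚ ∘ f)
  ℕ→ℚ-∑ []       f = refl
  ℕ→ℚ-∑ (x ∷ xs) f = trans (ℕ→ℚ-+ (f x) _) (cong (λ q → ℕ→ℚ (f x) + q) (ℕ→ℚ-∑ xs f))

  inv : ℕ → ℚ
  inv m = 1ℚ ÷ℕ m

  ÷ℕ≡*inv : ∀ q m → q ÷ℕ m ≡ q * inv m
  ÷ℕ≡*inv q zero    = sym (ℚ.*-zeroʳ q)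
  ÷ℕ≡*inv q (suc m) = cong (q *_) (sym (ℚ.*-identityˡ _))

  ℕ→ℚ-*-inv : ∀ m → m ≢ 0 → ℕ→ℚ m * inv m ≡ 1ℚ
  ℕ→ℚ-*-inv zero    m≢0 = ⊥-elim (m≢0 refl)
  ℕ→ℚ-*-inv (suc m) _
    rewrite ℚ.*-identityˡ (ℚ._/_ (+ 1) (suc m)) | ℕ→ℚ≡fromℕ (suc m)
          | ℚ.normalize-coprime {1} {m} (Coprime.1-coprimeTo (suc m)) =
    ℚ.toℚᵘ-injective
      (ℚᵘ.≃-trans (ℚ.toℚᵘ-homo-* (fromℕ (suc m)) (mkℚ (+ 1) m (Coprime.1-coprimeTo (suc m)))) (*≡* cross))
    where
    cross : (+ suc m ℤ.* + 1) ℤ.* + 1 ≡ + 1 ℤ.* + suc (m ℕ.+ 0)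
    cross rewrite ℤ.*-identityʳ (+ suc m ℤ.* + 1) | ℤ.*-identityʳ (+ suc m) | ℕ.+-identityʳ m =
      sym (ℤ.*-identityˡ (+ suc m))

  inv-* : ∀ a b → a ℕ.* b ≢ 0 → ℕ→ℚ b * inv (a ℕ.* b) ≡ inv a
  inv-* a b ab≢0 = begin
    y                                         ≡⟨ ℚ.*-identityˡ y ⟨
    1ℚ * y                                    ≡⟨ cong (_* y) (trans (ℚ.*-comm (inv a) (ℕ→ℚ a)) (ℕ→ℚ-*-inv a a≢0)) ⟨
    inv a * ℕ→ℚ a * y                         ≡⟨ ℚ.*-assoc (inv a) (ℕ→ℚ a) y ⟩
    inv a * (ℕ→ℚ a * y)                       ≡⟨ cong (inv a *_) (ℚ.*-assoc (ℕ→ℚ a) (ℕ→ℚ b) _) ⟨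
    inv a * (ℕ→ℚ a * ℕ→ℚ b * inv (a ℕ.* b))   ≡⟨ cong (λ q → inv a * (q * inv (a ℕ.* b))) (ℕ→ℚ-* a b) ⟨
    inv a * (ℕ→ℚ (a ℕ.* b) * inv (a ℕ.* b))   ≡⟨ cong (inv a *_) (ℕ→ℚ-*-inv (a ℕ.* b) ab≢0) ⟩
    inv a * 1ℚ                                ≡⟨ ℚ.*-identityʳ (inv a) ⟩
    inv a                                     ∎
    where
    open ≡-Reasoning
    y = ℕ→ℚ b * inv (a ℕ.* b)
    a≢0 : a ≢ 0
    a≢0 refl = ab≢0 refl

  ÷ℕ-cancelʳ : ∀ q a b → a ℕ.* b ≢ 0 → (q * ℕ→ℚ b) ÷ℕ (a ℕ.* b) ≡ q ÷ℕ a
  ÷ℕ-cancelʳ q a b ab≢0 = begin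
    (q * ℕ→ℚ b) ÷ℕ (a ℕ.* b)       ≡⟨ ÷ℕ≡*inv _ (a ℕ.* b) ⟩
    q * ℕ→ℚ b * inv (a ℕ.* b)       ≡⟨ ℚ.*-assoc q (ℕ→ℚ b) _ ⟩
    q * (ℕ→ℚ b * inv (a ℕ.* b))     ≡⟨ cong (q *_) (inv-* a b ab≢0) ⟩
    q * inv a                       ≡⟨ ÷ℕ≡*inv q a ⟨
    q ÷ℕ a                          ∎
    where open ≡-Reasoning

  module _ {n : ℕ} where

    -- M σ n is classAverage (ℕ→ℚ ∘ N σ) by definition.
    classAverage : (Perm n → ℚ) → Perm n → ℚ
    classAverage g π = ∑ (conjClass π) g ÷ℕ length (conjClass π)

    ℕ→ℚ-length-conjClass : ∀ τ → ℕ→ℚ (length (conjClass τ)) ≡ ∑ (Sym n) (λ π → [ conjugate τ π ]· 1ℚ)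
    ℕ→ℚ-length-conjClass τ = trans (cong ℕ→ℚ (Counting.length-filterᵇ (conjugate τ) (Sym n)))
                                   (trans (ℕ→ℚ-∑ (Sym n) _) (∑-cong (Sym n) (λ π → ℕ→ℚ-[]·1 (conjugate τ π))))
      where
      ℕ→ℚ-[]·1 : ∀ b → ℕ→ℚ (Counting.[ b ]· 1) ≡ [ b ]· 1ℚ
      ℕ→ℚ-[]·1 true  = refl
      ℕ→ℚ-[]·1 false = refl

    module _ (f g : Perm n → ℚ) (f-invariant : ∀ {π τ} → conjugate π τ ≡ true → f π ≡ f τ) where

      *-classAverage : ∀ π → f π * classAverage g π
                             ≡ ∑ (Sym n) (λ τ → [ conjugate π τ ]· (f τ * (g τ * inv (length (conjClass τ)))))
      *-classAverage π = begin
        f π * (∑ (conjClass π) g ÷ℕ c)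
          ≡⟨ cong (f π *_) (trans (÷ℕ≡*inv _ c) (cong (_* inv c) (∑-filter (conjugate π) (Sym n) g))) ⟩
        f π * (∑ (Sym n) (λ τ → [ conjugate π τ ]· g τ) * inv c)
          ≡⟨ cong (f π *_) (*-distribʳ-∑ (inv c) (Sym n) _) ⟩
        f π * ∑ (Sym n) (λ τ → [ conjugate π τ ]· g τ * inv c)
          ≡⟨ *-distribˡ-∑ (f π) (Sym n) _ ⟩
        ∑ (Sym n) (λ τ → f π * ([ conjugate π τ ]· g τ * inv c))
          ≡⟨ ∑-cong (Sym n) move-to-τ ⟩
        ∑ (Sym n) (λ τ → [ conjugate π τ ]· (f τ * (g τ * inv (length (conjClass τ))))) ∎
        where
        open ≡-Reasoning
        c = length (conjClass π)
        move-to-τ : ∀ τ → f π * ([ conjugate π τ ]· g τ * inv c)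
                          ≡ [ conjugate π τ ]· (f τ * (g τ * inv (length (conjClass τ))))
        move-to-τ τ with conjugate π τ in conj
        ... | true  = cong₂ (λ a m → a * (g τ * inv m)) (f-invariant {π} {τ} conj) (length-conjClass {n} {π} {τ} conj)
        ... | false = trans (cong (f π *_) (ℚ.*-zeroˡ (inv c))) (ℚ.*-zeroʳ (f π))

      ∑-*-classAverage : ∑ (Sym n) (λ π → f π * classAverage g π) ≡ ∑ (Sym n) (λ π → f π * g π)
      ∑-*-classAverage = begin
        ∑ (Sym n) (λ π → f π * classAverage g π)
          ≡⟨ ∑-cong (Sym n) *-classAverage ⟩
        ∑ (Sym n) (λ π → ∑ (Sym n) (λ τ → [ conjugate π τ ]· h τ))
          ≡⟨ ∑-comm (Sym n) (Sym n) _ ⟩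
        ∑ (Sym n) (λ τ → ∑ (Sym n) (λ π → [ conjugate π τ ]· h τ))
          ≡⟨ ∑-cong (Sym n) (λ τ → ∑-cong (Sym n) (λ π →
               trans (cong ([_]· h τ) (conjugate-comm π τ)) (sym ([]·1-* (conjugate τ π) (h τ))))) ⟩
        ∑ (Sym n) (λ τ → ∑ (Sym n) (λ π → [ conjugate τ π ]· 1ℚ * h τ))
          ≡⟨ ∑-cong (Sym n) (λ τ → sym (*-distribʳ-∑ (h τ) (Sym n) _)) ⟩
        ∑ (Sym n) (λ τ → ∑ (Sym n) (λ π → [ conjugate τ π ]· 1ℚ) * h τ)
          ≡⟨ ∑-cong (Sym n) (λ τ → cong (_* h τ) (sym (ℕ→ℚ-length-conjClass τ))) ⟩
        ∑ (Sym n) (λ τ → ℕ→ℚ (c τ) * h τ)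
          ≡⟨ ∑-cong-∈ (Sym n) cancel ⟩
        ∑ (Sym n) (λ τ → f τ * g τ) ∎
        where
        open ≡-Reasoning
        c : Perm n → ℕ
        c π = length (conjClass π)
        h : Perm n → ℚ
        h τ = f τ * (g τ * inv (c τ))
        cancel : ∀ {τ} → τ ∈ Sym n → ℕ→ℚ (c τ) * h τ ≡ f τ * g τ
        cancel {τ} τ∈ = begin
          ℕ→ℚ (c τ) * (f τ * (g τ * inv (c τ)))   ≡⟨ x∙yz≈y∙xz (ℕ→ℚ (c τ)) (f τ) _ ⟩
          f τ * (ℕ→ℚ (c τ) * (g τ * inv (c τ)))   ≡⟨ cong (f τ *_) (x∙yz≈y∙xz (ℕ→ℚ (c τ)) (g τ) _) ⟩
          f τ * (g τ * (ℕ→ℚ (c τ) * inv (c τ)))   ≡⟨ cong (λ q → f τ * (g τ * q)) (ℕ→ℚ-*-inv (c τ) (length-conjClass≢0 τ∈)) ⟩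
          f τ * (g τ * 1ℚ)                        ≡⟨ cong (f τ *_) (ℚ.*-identityʳ (g τ)) ⟩
          f τ * g τ                               ∎

  nPk*[n∸k]!≡n! : ∀ {n k} → k ≤ n → (n P k) ℕ.* (n ∸ k) ! ≡ n !
  nPk*[n∸k]!≡n! {n} {k} k≤n = trans (cong (ℕ._* (n ∸ k) !) (nPk≡n!/[n∸k]! k≤n))
                                    (m/n*n≡m {{(n ∸ k) ℕ.!≢0}} (∣-trans (m∣m*n (k !)) ([n∸k]!k!∣n! k≤n)))

  nCk*k![n∸k]!≡n! : ∀ {n k} → k ≤ n → (n C k) ℕ.* (k ! ℕ.* (n ∸ k) !) ≡ n !
  nCk*k![n∸k]!≡n! {n} {k} k≤n = trans (cong (ℕ._* (k ! ℕ.* (n ∸ k) !)) (nCk≡n!/k![n-k]! k≤n))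
                                      (m/n*n≡m {{k ℕ.!* (n ∸ k) !≢0}} (k![n∸k]!∣n! k≤n))

  ∑[a-1]b≡∑ab-∑b : ∀ {B : Set} (xs : List B) (a b : B → ℕ) →
          ∑ xs (λ x → (ℕ→ℚ (a x) - 1ℚ) * ℕ→ℚ (b x)) ≡ ℕ→ℚ (Counting.∑ xs (λ x → a x ℕ.* b x)) - ℕ→ℚ (Counting.∑ xs b)
  ∑[a-1]b≡∑ab-∑b []       a b = refl
  ∑[a-1]b≡∑ab-∑b (x ∷ xs) a b = begin
    (p - 1ℚ) * q + ∑ xs (λ x → (ℕ→ℚ (a x) - 1ℚ) * ℕ→ℚ (b x))
      ≡⟨ cong₂ _+_ minus-one (∑[a-1]b≡∑ab-∑b xs a b) ⟩
    (p * q - q) + (ℕ→ℚ s - ℕ→ℚ t)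
      ≡⟨ regroup (p * q) q (ℕ→ℚ s) (ℕ→ℚ t) ⟩
    (p * q + ℕ→ℚ s) - (q + ℕ→ℚ t)
      ≡⟨ cong₂ (λ u v → (u + ℕ→ℚ s) - v) (ℕ→ℚ-* (a x) (b x)) (ℕ→ℚ-+ (b x) t) ⟨
    (ℕ→ℚ (a x ℕ.* b x) + ℕ→ℚ s) - ℕ→ℚ (b x ℕ.+ t)
      ≡⟨ cong (_- ℕ→ℚ (b x ℕ.+ t)) (ℕ→ℚ-+ (a x ℕ.* b x) s) ⟨
    ℕ→ℚ (a x ℕ.* b x ℕ.+ s) - ℕ→ℚ (b x ℕ.+ t) ∎
    where
    open ≡-Reasoning
    p = ℕ→ℚ (a x)
    q = ℕ→ℚ (b x)
    s = Counting.∑ xs (λ x → a x ℕ.* b x)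
    t = Counting.∑ xs b
    minus-one : (p - 1ℚ) * q ≡ p * q - q
    minus-one = trans (ℚ.*-distribʳ-+ q p (- 1ℚ))
                      (cong (λ r → p * q + r) (trans (sym (ℚ.neg-distribˡ-* 1ℚ q)) (cong -_ (ℚ.*-identityˡ q))))
    regroup : ∀ u v w z → (u - v) + (w - z) ≡ (u + w) - (v + z)
    regroup = solve 4 (λ u v w z → (u :- v) :+ (w :- z) := (u :+ w) :- (v :+ z)) refl
      where open +-*-Solver

  ÷ℕ-distrib-- : ∀ p q m → (p - q) ÷ℕ m ≡ p ÷ℕ m - q ÷ℕ m
  ÷ℕ-distrib-- p q m rewrite ÷ℕ≡*inv (p - q) m | ÷ℕ≡*inv p m | ÷ℕ≡*inv q m = distrib p q (inv m)
    where
    open +-*-Solver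
    distrib : ∀ p q i → (p - q) * i ≡ p * i - q * i
    distrib = solve 3 (λ p q i → (p :- q) :* i := p :* i :- q :* i) refl

  -- Used with a = P(n,k), b = k!, F = (n−k)!, D the double sum, c = C(n,k), c₀ = C(n−1,k−1), c₁ = C(n−1,k).
  quotient-of-moments : ∀ {n! a b F D c c₀ c₁} → a ℕ.* F ≡ n! → c ℕ.* (b ℕ.* F) ≡ n! → c₀ ℕ.+ c₁ ≡ c → n! ≢ 0 →
    (ℕ→ℚ (F ℕ.* (D ℕ.+ c ℕ.* c₁)) - ℕ→ℚ (F ℕ.* (c ℕ.* c))) ÷ℕ n! ≡ ℕ→ℚ D ÷ℕ a - ℕ→ℚ c₀ ÷ℕ b
  quotient-of-moments {n!} {a} {b} {F} {D} {c} {c₀} {c₁} a*F≡n! c*bF≡n! refl n!≢0 = begin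
    (ℕ→ℚ (F ℕ.* (D ℕ.+ c ℕ.* c₁)) - ℕ→ℚ (F ℕ.* (c ℕ.* c))) ÷ℕ n!
      ≡⟨ cong₂ (λ u v → (ℕ→ℚ u - ℕ→ℚ v) ÷ℕ n!) expand-left expand-right ⟩
    (ℕ→ℚ (D ℕ.* F ℕ.+ c₁ ℕ.* cF) - ℕ→ℚ (c₀ ℕ.* cF ℕ.+ c₁ ℕ.* cF)) ÷ℕ n!
      ≡⟨ cong (_÷ℕ n!) (cancel (D ℕ.* F) (c₀ ℕ.* cF) (c₁ ℕ.* cF)) ⟩
    (ℕ→ℚ (D ℕ.* F) - ℕ→ℚ (c₀ ℕ.* cF)) ÷ℕ n!
      ≡⟨ ÷ℕ-distrib-- _ _ n! ⟩
    ℕ→ℚ (D ℕ.* F) ÷ℕ n! - ℕ→ℚ (c₀ ℕ.* cF) ÷ℕ n!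
      ≡⟨ cong₂ (λ u v → ℕ→ℚ (D ℕ.* F) ÷ℕ u - ℕ→ℚ (c₀ ℕ.* cF) ÷ℕ v) (sym a*F≡n!) (sym b*cF≡n!) ⟩
    ℕ→ℚ (D ℕ.* F) ÷ℕ (a ℕ.* F) - ℕ→ℚ (c₀ ℕ.* cF) ÷ℕ (b ℕ.* cF)
      ≡⟨ cong₂ _-_ (trans (cong (_÷ℕ (a ℕ.* F)) (ℕ→ℚ-* D F)) (÷ℕ-cancelʳ (ℕ→ℚ D) a F (subst (_≢ 0) (sym a*F≡n!) n!≢0)))
                   (trans (cong (_÷ℕ (b ℕ.* cF)) (ℕ→ℚ-* c₀ cF)) (÷ℕ-cancelʳ (ℕ→ℚ c₀) b cF (subst (_≢ 0) (sym b*cF≡n!) n!≢0))) ⟩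
    ℕ→ℚ D ÷ℕ a - ℕ→ℚ c₀ ÷ℕ b ∎
    where
    open ≡-Reasoning
    cF = (c₀ ℕ.+ c₁) ℕ.* F
    b*cF≡n! : b ℕ.* cF ≡ n!
    b*cF≡n! = trans (solve 3 (λ b c F → b :* (c :* F) := c :* (b :* F)) refl b (c₀ ℕ.+ c₁) F) c*bF≡n!
      where open ℕ-Solver
    expand-left : F ℕ.* (D ℕ.+ (c₀ ℕ.+ c₁) ℕ.* c₁) ≡ D ℕ.* F ℕ.+ c₁ ℕ.* cF
    expand-left = solve 4 (λ F D c₀ c₁ → F :* (D :+ (c₀ :+ c₁) :* c₁) := D :* F :+ c₁ :* ((c₀ :+ c₁) :* F))
                          refl F D c₀ c₁
      where open ℕ-Solver
    expand-right : F ℕ.* ((c₀ ℕ.+ c₁) ℕ.* (c₀ ℕ.+ c₁)) ≡ c₀ ℕ.* cF ℕ.+ c₁ ℕ.* cF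
    expand-right = solve 3 (λ F c₀ c₁ → F :* ((c₀ :+ c₁) :* (c₀ :+ c₁))
                                        := c₀ :* ((c₀ :+ c₁) :* F) :+ c₁ :* ((c₀ :+ c₁) :* F))
                           refl F c₀ c₁
      where open ℕ-Solver
    cancel : ∀ x y z → ℕ→ℚ (x ℕ.+ z) - ℕ→ℚ (y ℕ.+ z) ≡ ℕ→ℚ x - ℕ→ℚ y
    cancel x y z = trans (cong₂ _-_ (ℕ→ℚ-+ x z) (ℕ→ℚ-+ y z)) (+-cancel (ℕ→ℚ x) (ℕ→ℚ y) (ℕ→ℚ z))
      where
      open +-*-Solver
      +-cancel : ∀ p q r → (p + r) - (q + r) ≡ p - q
      +-cancel = solve 3 (λ p q r → (p :+ r) :- (q :+ r) := p :- q) refl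

  a1≡moments : ∀ {k} (σ : Permutation′ k) n →
    a1 σ n ≡ (ℕ→ℚ (Counting.∑ (Sym n) (λ π → fixedPoints π ℕ.* N σ π)) - ℕ→ℚ (Counting.∑ (Sym n) (N σ))) ÷ℕ (n !)
  a1≡moments σ n = cong (_÷ℕ (n !)) (trans (∑-*-classAverage (χstd n) (ℕ→ℚ ∘ N σ) (λ {π} {τ} → χ-invariant {π} {τ}))
                                           (∑[a-1]b≡∑ab-∑b (Sym n) fixedPoints (N σ)))
    where
    χ-invariant : ∀ {π τ} → conjugate π τ ≡ true → χstd n π ≡ χstd n τ
    χ-invariant {π} {τ} conj = cong (λ m → ℕ→ℚ m - 1ℚ) (fixedPoints-conjugate {n} {π} {τ} conj)

open import Defs
open import Data.Nat using (ℕ; suc; _≤_; _<_; _+_; _∸_; _!; ≢-nonZero⁻¹)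
open import Data.Nat.Combinatorics using (_C_; _P_; nCk+nC[k+1]≡[n+1]C[k+1])
open import Data.Nat.Properties using (+-comm; <⇒≤; _!≢0)
open import Data.Fin.Permutation using (Permutation′)
import Data.Rational as ℚ
open import Relation.Binary.PropositionalEquality using (_≡_; trans; cong₂; subst)

proposition3p1 : (k : ℕ) → 1 ≤ k → (σ : Permutation′ k) →
    (n : ℕ) → k + 1 ≤ n → a1 σ n ≡ rhs σ n
proposition3p1 k@(suc k′) _ σ n@(suc n′) k+1≤n =
  trans (Rational.a1≡moments σ n)
        (trans (cong₂ (λ s t → (ℕ→ℚ s ℚ.- ℕ→ℚ t) ÷ℕ (n !)) (Counting.∑-fixedPoints*N σ k<n) (Counting.∑-N {n} σ))
               (Rational.quotient-of-moments {a = n P k} {b = k !} {F = (n ∸ k) !} {D = doubleSum σ n}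
                                             {c = n C k} {c₀ = n′ C k′} {c₁ = n′ C k}
                  (Rational.nPk*[n∸k]!≡n! (<⇒≤ k<n))
                  (Rational.nCk*k![n∸k]!≡n! (<⇒≤ k<n))
                  (nCk+nC[k+1]≡[n+1]C[k+1] n′ k′)
                  (≢-nonZero⁻¹ (n !) {{n !≢0}})))
  where
  k<n : k < n
  k<n = subst (_≤ n) (+-comm k 1) k+1≤n
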